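{- Let $l$ be a positive integer, $S_1,S_2$ centred Catalan sets, $A_1$ an $(|S_1|-1,l)$-AS-trapezoid and $A_2$ an $(|S_2|-1,\,l+2|S_1|-2)$-AS-trapezoid with $\mathcal{S}(A_i)=S_i$ for $i=1,2$. Placing $A_2$ centred on top of $A_1$ yields an $(|S_1\circ S_2|-1,l)$-AS-trapezoid $A$ with $\mathcal{S}(A)=S_1\circ S_2$. Further, every $(|S_1\circ S_2|-1,l)$-AS-trapezoid $A$ with $\mathcal{S}(A)=S_1\circ S_2$ arises in this way, i.e. its bottom $|S_1|-1$ rows form an $(|S_1|-1,l)$-AS-trapezoid $A_1$ with $\mathcal{S}(A_1)=S_1$ and its remaining rows form an $(|S_2|-1,l+2|S_1|-2)$-AS-trapezoid $A_2$ with $\mathcal{S}(A_2)=S_2$.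
   Context: A centred Catalan set of size $m$ is an $m$-subset $S$ of $\{ -m+1,\dots,m-1\}$ with $|S\cap\{ -i,\dots,i\}|\ge i+1$ for all $0\le i\le m-1$. For an integer $k$, $\mathfrak{s}_k(x)=x+k$ for $x>0$, $\mathfrak{s}_k(0)=0$, $\mathfrak{s}_k(x)=x-k$ for $x<0$, applied elementwise to sets; $S_1\circ S_2:=S_1\cup\mathfrak{s}_{|S_1|-1}(S_2)$. An $(n,l)$-AS-trapezoid is an array of $n$ centred rows, the $i$-th row from the bottom having $l+2i-1$ entries from $\{ -1,0,1\}$, such that all row sums are $1$, the column sums of the central $l-1$ columns are $0$, the nonzero entries in every row and in every column alternate in sign, and in every column the first nonzero entry from the top is positive. Label the columns $-n+1,\dots,l+n-1$ from left to right. $\mathcal{S}(A)$ is $\{0\}\cup\{c-1: c\le 0,\ \text{column } c\text{ has positive sum}\}\cup\{c-(l-1): c\ge1,\ \text{column } c\text{ has positive sum}\}$. -}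

module Defs where

open import Data.Bool using (if_then_else_)
open import Data.Nat as ℕ using (ℕ; zero; suc; _∸_; _≤ᵇ_)
open import Data.Integer as ℤ using (ℤ; +_; -_; _+_; _-_; 0ℤ; 1ℤ; -1ℤ; ∣_∣; -[1+_])
open import Data.List using (List; []; _∷_; map; filter; length; foldr; deduplicate; _++_)
open import Data.List.Relation.Unary.All using (All)
open import Data.List.Relation.Unary.Unique.Propositional using (Unique)
open import Data.List.Membership.Propositional using (_∈_)
open import Data.Product using (_×_; ∃-syntax)
open import Data.Sum using (_⊎_)
open import Data.Unit using (⊤)
open import Function.Bundles using (_⇔_)
open import Relation.Nullary using (¬?)
open import Relation.Binary.PropositionalEquality using (_≡_; _≢_)

-- Finite sets of integers are lists without repetition; |S| = length S.

record IsCentredCatalan (S : List ℤ) : Set where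
  field
    unique : Unique S
    bounds : All (λ x → (1ℤ - + length S) ℤ.≤ x × x ℤ.≤ (+ length S - 1ℤ)) S
    catalan : ∀ i → i ℕ.< length S →
              suc i ℕ.≤ length (filter (λ x → ∣ x ∣ ℕ.≤? i) S)

shift : ℕ → ℤ → ℤ
shift k (+ zero)    = 0ℤ
shift k (+ (suc m)) = + suc m + + k
shift k -[1+ m ]    = -[1+ m ] - + k

_∘ₛ_ : List ℤ → List ℤ → List ℤ
S₁ ∘ₛ S₂ = deduplicate ℤ._≟_ (S₁ ++ map (shift (length S₁ ∸ 1)) S₂)

-- Arrays: A i c = entry in row i (counted from the bottom, starting at 1)
-- and column with label c; entries outside the trapezoid shape are 0.

sumℤ : List ℤ → ℤ
sumℤ = foldr _+_ 0ℤ

Array : Set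
Array = ℕ → ℤ → ℤ

range : ℤ → ℕ → List ℤ
range a zero = []
range a (suc k) = a ∷ range (a + 1ℤ) k

rowsTopDown : ℕ → List ℕ
rowsTopDown zero = []
rowsTopDown (suc n) = suc n ∷ rowsTopDown n

rowList : ℕ → Array → ℕ → List ℤ
rowList l A i = map (A i) (range (1ℤ - + i) (l ℕ.+ 2 ℕ.* i ∸ 1))

colList : ℕ → Array → ℤ → List ℤ
colList n A c = map (λ i → A i c) (rowsTopDown n)

colSum : ℕ → Array → ℤ → ℤ
colSum n A c = sumℤ (colList n A c)

InShape : ℕ → ℕ → ℕ → ℤ → Set
InShape n l i c = 1 ℕ.≤ i × i ℕ.≤ n × (1ℤ - + i) ℤ.≤ c × c ℤ.≤ (+ l + + i - 1ℤ)

IsColumn : ℕ → ℕ → ℤ → Set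
IsColumn n l c = (1ℤ - + n) ℤ.≤ c × c ℤ.≤ (+ l + + n - 1ℤ)

nonzeros : List ℤ → List ℤ
nonzeros = filter (λ x → ¬? (x ℤ.≟ 0ℤ))

Alternating : List ℤ → Set
Alternating [] = ⊤
Alternating (x ∷ []) = ⊤
Alternating (x ∷ y ∷ r) =
  ((0ℤ ℤ.< x × y ℤ.< 0ℤ) ⊎ (x ℤ.< 0ℤ × 0ℤ ℤ.< y)) × Alternating (y ∷ r)

FirstPositive : List ℤ → Set
FirstPositive [] = ⊤
FirstPositive (x ∷ _) = 0ℤ ℤ.< x

record IsASTrapezoid (n l : ℕ) (A : Array) : Set where
  field
    entries  : ∀ i c → A i c ≡ 0ℤ ⊎ A i c ≡ 1ℤ ⊎ A i c ≡ -1ℤ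
    support  : ∀ i c → A i c ≢ 0ℤ → InShape n l i c
    rowSums  : ∀ i → 1 ℕ.≤ i → i ℕ.≤ n → sumℤ (rowList l A i) ≡ 1ℤ
    central  : ∀ c → 1ℤ ℤ.≤ c → c ℤ.≤ (+ l - 1ℤ) → colSum n A c ≡ 0ℤ
    rowAlt   : ∀ i → 1 ℕ.≤ i → i ℕ.≤ n → Alternating (nonzeros (rowList l A i))
    colAlt   : ∀ c → IsColumn n l c → Alternating (nonzeros (colList n A c))
    colFirst : ∀ c → IsColumn n l c → FirstPositive (nonzeros (colList n A c))

In𝒮 : ℕ → ℕ → Array → ℤ → Set
In𝒮 n l A x =
  x ≡ 0ℤ
  ⊎ (∃[ c ] IsColumn n l c × c ℤ.≤ 0ℤ × 0ℤ ℤ.< colSum n A c × x ≡ c - 1ℤ)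
  ⊎ (∃[ c ] IsColumn n l c × 1ℤ ℤ.≤ c × 0ℤ ℤ.< colSum n A c × x ≡ c - (+ l - 1ℤ))

𝒮≡ : ℕ → ℕ → Array → List ℤ → Set
𝒮≡ n l A S = ∀ x → In𝒮 n l A x ⇔ x ∈ S

stack : ℕ → Array → Array → Array
stack n₁ A₁ A₂ i c = if i ≤ᵇ n₁ then A₁ i c else A₂ (i ∸ n₁) (c + + n₁)

bottomRows : ℕ → Array → Array
bottomRows n₁ A i c = if i ≤ᵇ n₁ then A i c else 0ℤ

topRows : ℕ → Array → Array
topRows n₁ A zero c = 0ℤ
topRows n₁ A (suc j) c = A (suc j ℕ.+ n₁) (c - + n₁)

-- The nonzero entries of a column alternate in sign and start positively exactly when its partial
-- sums, read from the top, stay in {0, 1}. So every column sum is 0 or 1, and a nonzero x lies in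
-- 𝒮(A) iff the one column through which it can enter 𝒮(A) (columnOf l x) has sum 1.
-- Stacking: every column of A₁ lies below a central, sum-zero column of A₂, and A₁ vanishes on the
-- remaining columns, so the column walks concatenate and 𝒮 of the stack is S₁ ∪ 𝔰(S₂).
-- Splitting: the top |S₂| - 1 rows have total sum |S₂| - 1, and the |S₂| - 1 outer columns of the
-- nonzero elements of 𝔰(S₂) already carry top sum 1 each. Top sums are nonnegative (prefix sums of
-- walks), so every column of the bottom part has top sum 0; the top part of such a column is then a
-- closed walk, and both parts inherit the trapezoid conditions.

module Submission where

open import Defs

module Composition where

  open import Data.Bool using (Bool; true; false; T)
  open import Data.Nat as ℕ using (ℕ; zero; suc)
  import Data.Nat.Properties as ℕP
  import Data.Nat.Tactic.RingSolver as ℕSolver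
  open import Data.Integer as ℤ using (ℤ; +_; -_; _+_; _-_; 0ℤ; 1ℤ; -1ℤ; -[1+_])
  import Data.Integer.Properties as ℤP
  open import Data.Integer.Tactic.RingSolver using (solve-∀)
  open import Data.List using (List; []; _∷_; length; map; _++_)
  import Data.List.Properties as ListP
  open import Data.List.Relation.Unary.All as All using (All; []; _∷_)
  import Data.List.Relation.Unary.All.Properties as AllP
  open import Data.List.Relation.Unary.Any using (here; there)
  open import Data.List.Relation.Unary.AllPairs using ([]; _∷_)
  open import Data.List.Relation.Unary.Unique.Propositional using (Unique)
  import Data.List.Relation.Unary.Unique.Propositional.Properties as UniqueP
  open import Data.List.Relation.Unary.Unique.DecPropositional.Properties ℤ._≟_ using (deduplicate-!)
  open import Data.List.Membership.Propositional using (_∈_)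
  open import Data.List.Membership.Propositional.Properties
    using (∈-map⁺; ∈-map⁻; ∈-∃++; ∈-++⁻; ∈-++⁺ˡ; ∈-++⁺ʳ; ∈-deduplicate⁻; ∈-deduplicate⁺; ∈-filter⁻)
  open import Data.List.Membership.Propositional.Properties.WithK using (unique∧set⇒bag)
  open import Data.List.Relation.Binary.BagAndSetEquality using (∼bag⇒↭)
  open import Data.List.Relation.Binary.Permutation.Propositional using (_↭_)
  open import Data.List.Relation.Binary.Permutation.Propositional.Properties using (↭-length)
  open import Data.Product using (_×_; _,_; proj₁; proj₂; Σ)
  open import Data.Sum as Sum using (_⊎_; inj₁; inj₂)
  open import Data.Unit using (⊤; tt)
  open import Data.Empty using (⊥-elim)
  open import Function.Base using (_∘_)
  open import Function.Bundles using (mk⇔; Equivalence)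
  open import Relation.Binary.PropositionalEquality
  open import Relation.Nullary using (¬_; Dec; yes; no; _×-dec_)

  sumℤ-++ : ∀ xs ys → sumℤ (xs ++ ys) ≡ sumℤ xs + sumℤ ys
  sumℤ-++ [] ys = sym (ℤP.+-identityˡ _)
  sumℤ-++ (x ∷ xs) ys = trans (cong (λ s → x + s) (sumℤ-++ xs ys)) (sym (ℤP.+-assoc x _ _))

  sumℤ-zeros : ∀ {xs} → All (_≡ 0ℤ) xs → sumℤ xs ≡ 0ℤ
  sumℤ-zeros [] = refl
  sumℤ-zeros (refl ∷ zs) = trans (ℤP.+-identityˡ _) (sumℤ-zeros zs)

  sumℤ-map-++ : ∀ {B : Set} (f : B → ℤ) xs ys → sumℤ (map f (xs ++ ys)) ≡ sumℤ (map f xs) + sumℤ (map f ys)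
  sumℤ-map-++ f xs ys = trans (cong sumℤ (ListP.map-++ f xs ys)) (sumℤ-++ (map f xs) (map f ys))

  sumℤ-map-+ : ∀ {B : Set} (f g : B → ℤ) xs → sumℤ (map (λ x → f x + g x) xs) ≡ sumℤ (map f xs) + sumℤ (map g xs)
  sumℤ-map-+ f g [] = refl
  sumℤ-map-+ f g (x ∷ xs) = trans (cong (λ t → f x + g x + t) (sumℤ-map-+ f g xs)) (ring (f x) (g x) _ _)
    where
    ring : ∀ a b c d → a + b + (c + d) ≡ a + c + (b + d)
    ring = solve-∀

  sumℤ-map-swap : ∀ {B C : Set} (F : B → C → ℤ) (xs : List B) (ys : List C) →
    sumℤ (map (λ y → sumℤ (map (λ x → F x y) xs)) ys) ≡ sumℤ (map (λ x → sumℤ (map (F x) ys)) xs)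
  sumℤ-map-swap F xs [] = sym (sumℤ-zeros (AllP.map⁺ (All.tabulate {xs = xs} (λ _ → refl))))
  sumℤ-map-swap F xs (y ∷ ys) = trans (cong (λ t → sumℤ (map (λ x → F x y) xs) + t) (sumℤ-map-swap F xs ys))
    (sym (sumℤ-map-+ (λ x → F x y) (λ x → sumℤ (map (F x) ys)) xs))

  sumℤ-map-nonneg : ∀ {B : Set} (f : B → ℤ) xs → (∀ x → 0ℤ ℤ.≤ f x) → 0ℤ ℤ.≤ sumℤ (map f xs)
  sumℤ-map-nonneg f [] _ = ℤP.≤-refl
  sumℤ-map-nonneg f (x ∷ xs) f≥0 = ℤP.+-mono-≤ (f≥0 x) (sumℤ-map-nonneg f xs f≥0)

  record Removal {A : Set} (x : A) (xs ys : List A) : Set where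
    field
      unique : Unique ys
      length-suc : length xs ≡ suc (length ys)
      ∈⁻ : ∀ {y} → y ∈ ys → y ∈ xs
      all≢ : All (_≢ x) ys
      ∈⁺ : ∀ {y} → y ∈ xs → y ≢ x → y ∈ ys

  remove : ∀ {A : Set} {x : A} {xs} → Unique xs → x ∈ xs → Σ (List A) (Removal x xs)
  remove {x = x} unique x∈xs with ∈-∃++ x∈xs
  ... | us , vs , refl = us ++ vs , record
    { unique = proj₁ (unique-del us unique)
    ; length-suc = length-del us
    ; ∈⁻ = ∈-insert us
    ; all≢ = All.map (λ x≢y y≡x → x≢y (sym y≡x)) (proj₂ (unique-del us unique))
    ; ∈⁺ = ∈-delete us
    }
    where
    All-del : ∀ {P : _ → Set} us {vs} → All P (us ++ x ∷ vs) → P x × All P (us ++ vs)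
    All-del [] (px ∷ ps) = px , ps
    All-del (_ ∷ us) (pu ∷ ps) = let (px , ps′) = All-del us ps in px , pu ∷ ps′
    unique-del : ∀ us {vs} → Unique (us ++ x ∷ vs) → Unique (us ++ vs) × All (x ≢_) (us ++ vs)
    unique-del [] (x∉ ∷ u) = u , x∉
    unique-del (_ ∷ us) (u∉ ∷ u) =
      let (u′ , x∉) = unique-del us u ; (u≢x , u∉′) = All-del us u∉ in
      u∉′ ∷ u′ , (λ x≡u → u≢x (sym x≡u)) ∷ x∉
    length-del : ∀ us {vs} → length (us ++ x ∷ vs) ≡ suc (length (us ++ vs))
    length-del [] = refl
    length-del (_ ∷ us) = cong suc (length-del us)
    ∈-insert : ∀ us {vs y} → y ∈ us ++ vs → y ∈ us ++ x ∷ vs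
    ∈-insert us y∈ with ∈-++⁻ us y∈
    ... | inj₁ y∈us = ∈-++⁺ˡ y∈us
    ... | inj₂ y∈vs = ∈-++⁺ʳ us (there y∈vs)
    ∈-delete : ∀ us {vs y} → y ∈ us ++ x ∷ vs → y ≢ x → y ∈ us ++ vs
    ∈-delete us y∈ y≢x with ∈-++⁻ us y∈
    ... | inj₁ y∈us = ∈-++⁺ˡ y∈us
    ... | inj₂ (here y≡x) = ⊥-elim (y≢x y≡x)
    ... | inj₂ (there y∈vs) = ∈-++⁺ʳ us y∈vs

  Unique-map⁺-on : ∀ {A B : Set} {P : A → Set} (f : A → B) {xs} → All P xs →
    (∀ {x y} → P x → P y → f x ≡ f y → x ≡ y) → Unique xs → Unique (map f xs)
  Unique-map⁺-on f [] _ [] = []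
  Unique-map⁺-on {P = P} f {x ∷ xs} (px ∷ ps) injective (x∉ ∷ unique) =
    AllP.map⁺ (distinct ps x∉) ∷ Unique-map⁺-on f ps injective unique
    where
    distinct : ∀ {ys} → All P ys → All (x ≢_) ys → All (λ y → f x ≢ f y) ys
    distinct [] [] = []
    distinct (py ∷ ps) (x≢y ∷ x∉) = (λ eq → x≢y (injective px py eq)) ∷ distinct ps x∉

  length≤sumℤ-map : ∀ (f : ℤ → ℤ) xs ys → Unique ys → (∀ x → 0ℤ ℤ.≤ f x) →
    (∀ {y} → y ∈ ys → y ∈ xs) → (∀ {y} → y ∈ ys → f y ≡ 1ℤ) → + length ys ℤ.≤ sumℤ (map f xs)
  length≤sumℤ-map f xs [] _ f≥0 _ _ = sumℤ-map-nonneg f xs f≥0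
  length≤sumℤ-map f xs (y ∷ ys) (y∉ys ∷ unique) f≥0 ⊆xs f≡1 with ∈-∃++ (⊆xs (here refl))
  ... | us , vs , refl = subst (_ ℤ.≤_) (sym sum-split) (ℤP.+-monoʳ-≤ 1ℤ rest)
    where
    ⊆us++vs : ∀ {z} → z ∈ ys → z ∈ us ++ vs
    ⊆us++vs z∈ys with ∈-++⁻ us (⊆xs (there z∈ys))
    ... | inj₁ z∈us = ∈-++⁺ˡ z∈us
    ... | inj₂ (here refl) = ⊥-elim (All.lookup y∉ys z∈ys refl)
    ... | inj₂ (there z∈vs) = ∈-++⁺ʳ us z∈vs
    rest : + length ys ℤ.≤ sumℤ (map f (us ++ vs))
    rest = length≤sumℤ-map f (us ++ vs) ys unique f≥0 ⊆us++vs (λ z∈ys → f≡1 (there z∈ys))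
    ring : ∀ a b c → a + (b + c) ≡ b + (a + c)
    ring = solve-∀
    sum-split : sumℤ (map f (us ++ y ∷ vs)) ≡ 1ℤ + sumℤ (map f (us ++ vs))
    sum-split = begin
      sumℤ (map f (us ++ y ∷ vs))                   ≡⟨ sumℤ-map-++ f us (y ∷ vs) ⟩
      sumℤ (map f us) + (f y + sumℤ (map f vs))     ≡⟨ ring (sumℤ (map f us)) (f y) _ ⟩
      f y + (sumℤ (map f us) + sumℤ (map f vs))     ≡⟨ cong₂ _+_ (f≡1 (here refl)) (sym (sumℤ-map-++ f us vs)) ⟩
      1ℤ + sumℤ (map f (us ++ vs))                  ∎
      where open ≡-Reasoning

  -- Walks with partial sums in {0, 1}

  height : Bool → ℤ
  height false = 0ℤ
  height true = 1ℤ

  height-injective : ∀ {b b′} → height b ≡ height b′ → b ≡ b′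
  height-injective {false} {false} _ = refl
  height-injective {true} {true} _ = refl

  -- Walk01 b xs: starting at height b (false = 0, true = 1), the partial sums of xs stay in {0, 1}.
  data Walk01 : Bool → List ℤ → Set where
    []   : ∀ {b} → Walk01 b []
    flat : ∀ {b xs} → Walk01 b xs → Walk01 b (0ℤ ∷ xs)
    up   : ∀ {xs} → Walk01 true xs → Walk01 false (1ℤ ∷ xs)
    down : ∀ {xs} → Walk01 false xs → Walk01 true (-1ℤ ∷ xs)

  finalHeight : ∀ {b xs} → Walk01 b xs → Bool
  finalHeight {b} [] = b
  finalHeight (flat w) = finalHeight w
  finalHeight (up w) = finalHeight w
  finalHeight (down w) = finalHeight w

  Walk01-sum : ∀ {b xs} (w : Walk01 b xs) → height b + sumℤ xs ≡ height (finalHeight w)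
  Walk01-sum {false} [] = refl
  Walk01-sum {true} [] = refl
  Walk01-sum {b} (flat {xs = xs} w) = trans (cong (λ s → height b + s) (ℤP.+-identityˡ (sumℤ xs))) (Walk01-sum w)
  Walk01-sum (up w) = trans (ℤP.+-identityˡ _) (Walk01-sum w)
  Walk01-sum (down {xs} w) = trans (cancel (sumℤ xs)) (Walk01-sum w)
    where
    cancel : ∀ s → 1ℤ + (-1ℤ + s) ≡ 0ℤ + s
    cancel = solve-∀

  finalHeight-balanced : ∀ {b xs} (w : Walk01 b xs) → sumℤ xs ≡ 0ℤ → finalHeight w ≡ b
  finalHeight-balanced {b} {xs} w sum≡0 = sym (height-injective (begin
    height b                ≡⟨ sym (ℤP.+-identityʳ _) ⟩
    height b + 0ℤ           ≡⟨ cong (λ s → height b + s) (sym sum≡0) ⟩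
    height b + sumℤ xs      ≡⟨ Walk01-sum w ⟩
    height (finalHeight w)  ∎))
    where open ≡-Reasoning

  Walk01-sum01 : ∀ {xs} → Walk01 false xs → sumℤ xs ≡ 0ℤ ⊎ sumℤ xs ≡ 1ℤ
  Walk01-sum01 w with finalHeight w | Walk01-sum w
  ... | false | eq = inj₁ (trans (sym (ℤP.+-identityˡ _)) eq)
  ... | true  | eq = inj₂ (trans (sym (ℤP.+-identityˡ _)) eq)

  Walk01-sum-nonneg : ∀ {xs} → Walk01 false xs → 0ℤ ℤ.≤ sumℤ xs
  Walk01-sum-nonneg w with Walk01-sum01 w
  ... | inj₁ eq = ℤP.≤-reflexive (sym eq)
  ... | inj₂ eq = subst (0ℤ ℤ.≤_) (sym eq) (ℤ.+≤+ ℕ.z≤n)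

  Walk01-++ : ∀ {b xs ys} (w : Walk01 b xs) → Walk01 (finalHeight w) ys → Walk01 b (xs ++ ys)
  Walk01-++ [] v = v
  Walk01-++ (flat w) v = flat (Walk01-++ w v)
  Walk01-++ (up w) v = up (Walk01-++ w v)
  Walk01-++ (down w) v = down (Walk01-++ w v)

  Walk01-split : ∀ {b} xs {ys} → Walk01 b (xs ++ ys) → Σ (Walk01 b xs) λ w → Walk01 (finalHeight w) ys
  Walk01-split [] v = [] , v
  Walk01-split (_ ∷ xs) (flat v) = let (w , u) = Walk01-split xs v in flat w , u
  Walk01-split (_ ∷ xs) (up v) = let (w , u) = Walk01-split xs v in up w , u
  Walk01-split (_ ∷ xs) (down v) = let (w , u) = Walk01-split xs v in down w , u

  Walk01-++-balanced : ∀ {b xs ys} → Walk01 b xs → sumℤ xs ≡ 0ℤ → Walk01 b ys → Walk01 b (xs ++ ys)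
  Walk01-++-balanced w sum≡0 v = Walk01-++ w (subst (λ b → Walk01 b _) (sym (finalHeight-balanced w sum≡0)) v)

  Walk01-drop-balanced : ∀ {b} xs {ys} → Walk01 b (xs ++ ys) → sumℤ xs ≡ 0ℤ → Walk01 b ys
  Walk01-drop-balanced xs v sum≡0 =
    let (w , u) = Walk01-split xs v in subst (λ b → Walk01 b _) (finalHeight-balanced w sum≡0) u

  Walk01-zeros : ∀ {b ys} → All (_≡ 0ℤ) ys → Walk01 b ys
  Walk01-zeros [] = []
  Walk01-zeros (refl ∷ zs) = flat (Walk01-zeros zs)

  FirstSign : Bool → List ℤ → Set
  FirstSign false = FirstPositive
  FirstSign true [] = ⊤
  FirstSign true (x ∷ _) = x ℤ.< 0ℤ

  IsEntry : ℤ → Set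
  IsEntry x = x ≡ 0ℤ ⊎ x ≡ 1ℤ ⊎ x ≡ -1ℤ

  Alternating-∷-1 : ∀ ys → Alternating ys → FirstSign true ys → Alternating (1ℤ ∷ ys)
  Alternating-∷-1 [] _ _ = tt
  Alternating-∷-1 (_ ∷ _) alt y<0 = inj₁ (ℤ.+<+ (ℕ.s≤s ℕ.z≤n) , y<0) , alt

  Alternating-∷-−1 : ∀ ys → Alternating ys → FirstSign false ys → Alternating (-1ℤ ∷ ys)
  Alternating-∷-−1 [] _ _ = tt
  Alternating-∷-−1 (_ ∷ _) alt y>0 = inj₂ (ℤ.-<+ , y>0) , alt

  Walk01⇒Alternating : ∀ {b xs} → Walk01 b xs → Alternating (nonzeros xs) × FirstSign b (nonzeros xs)
  Walk01⇒Alternating {false} [] = tt , tt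
  Walk01⇒Alternating {true} [] = tt , tt
  Walk01⇒Alternating (flat w) = Walk01⇒Alternating w
  Walk01⇒Alternating (up {xs} w) =
    let (alt , sign) = Walk01⇒Alternating w in Alternating-∷-1 (nonzeros xs) alt sign , ℤ.+<+ (ℕ.s≤s ℕ.z≤n)
  Walk01⇒Alternating (down {xs} w) =
    let (alt , sign) = Walk01⇒Alternating w in Alternating-∷-−1 (nonzeros xs) alt sign , ℤ.-<+

  Alternating-tail : ∀ {x} ys → Alternating (x ∷ ys) → Alternating ys
  Alternating-tail [] _ = tt
  Alternating-tail (_ ∷ _) (_ , alt) = alt

  Alternating-next-after-pos : ∀ {x} ys → 0ℤ ℤ.< x → Alternating (x ∷ ys) → FirstSign true ys
  Alternating-next-after-pos [] _ _ = tt
  Alternating-next-after-pos (_ ∷ _) _ (inj₁ (_ , y<0) , _) = y<0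
  Alternating-next-after-pos (_ ∷ _) x>0 (inj₂ (x<0 , _) , _) = ⊥-elim (ℤP.<-asym x>0 x<0)

  Alternating-next-after-neg : ∀ {x} ys → x ℤ.< 0ℤ → Alternating (x ∷ ys) → FirstSign false ys
  Alternating-next-after-neg [] _ _ = tt
  Alternating-next-after-neg (_ ∷ _) x<0 (inj₁ (x>0 , _) , _) = ⊥-elim (ℤP.<-asym x<0 x>0)
  Alternating-next-after-neg (_ ∷ _) _ (inj₂ (_ , y>0) , _) = y>0

  Alternating⇒Walk01 : ∀ {b} xs → All IsEntry xs →
    Alternating (nonzeros xs) → FirstSign b (nonzeros xs) → Walk01 b xs
  Alternating⇒Walk01 [] [] _ _ = []
  Alternating⇒Walk01 (_ ∷ xs) (inj₁ refl ∷ es) alt sign = flat (Alternating⇒Walk01 xs es alt sign)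
  Alternating⇒Walk01 {false} (_ ∷ xs) (inj₂ (inj₁ refl) ∷ es) alt sign =
    up (Alternating⇒Walk01 xs es (Alternating-tail (nonzeros xs) alt) (Alternating-next-after-pos (nonzeros xs) sign alt))
  Alternating⇒Walk01 {true} (_ ∷ xs) (inj₂ (inj₁ refl) ∷ es) alt (ℤ.+<+ ())
  Alternating⇒Walk01 {false} (_ ∷ xs) (inj₂ (inj₂ refl) ∷ es) alt ()
  Alternating⇒Walk01 {true} (_ ∷ xs) (inj₂ (inj₂ refl) ∷ es) alt sign =
    down (Alternating⇒Walk01 xs es (Alternating-tail (nonzeros xs) alt) (Alternating-next-after-neg (nonzeros xs) sign alt))

  ≤-translate : ∀ {a b a′ b′ : ℤ} k → a + k ≡ a′ → b + k ≡ b′ → a ℤ.≤ b → a′ ℤ.≤ b′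
  ≤-translate k refl refl a≤b = ℤP.+-monoˡ-≤ k a≤b

  i+j-j≡i : ∀ i j → i + j - j ≡ i
  i+j-j≡i = solve-∀

  i-j+j≡i : ∀ i j → i - j + j ≡ i
  i-j+j≡i = solve-∀

  i-1<i : ∀ i → i - 1ℤ ℤ.< i
  i-1<i i = ℤP.suc[i]≤j⇒i<j (ℤP.≤-reflexive (ring i))
    where
    ring : ∀ i → 1ℤ + (i - 1ℤ) ≡ i
    ring = solve-∀

  ≤⇒≡+ : ∀ {a b} → a ℤ.≤ b → Σ ℕ λ d → b ≡ a + + d
  ≤⇒≡+ {a} {b} a≤b =
    ℤ.∣ b - a ∣ , trans (sym (ring a b)) (cong (λ t → a + t) (sym (ℤP.0≤i⇒+∣i∣≡i (ℤP.i≤j⇒0≤j-i a≤b))))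
    where
    ring : ∀ a b → a + (b - a) ≡ b
    ring = solve-∀

  +[1+m]≢-n : ∀ {m n} → + suc m ≢ - + n
  +[1+m]≢-n {n = zero} ()
  +[1+m]≢-n {n = suc n} ()

  +-cancelʳ : ∀ {a b} k → a + k ≡ b + k → a ≡ b
  +-cancelʳ {a} {b} k eq = trans (sym (i+j-j≡i a k)) (trans (cong (λ t → t - k) eq) (i+j-j≡i b k))

  pos-+-2* : ∀ l k → + (l ℕ.+ 2 ℕ.* k) ≡ + l + + k + + k
  pos-+-2* l k rewrite ℕP.+-identityʳ k | ℤP.pos-+ l (k ℕ.+ k) | ℤP.pos-+ k k =
    sym (ℤP.+-assoc (+ l) (+ k) (+ k))

  range-translate : ∀ a d k → map (_+ d) (range a k) ≡ range (a + d) k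
  range-translate a d zero = refl
  range-translate a d (suc k) = cong (a + d ∷_) (trans (range-translate (a + 1ℤ) d k) (cong (λ t → range t k) (ring a d)))
    where
    ring : ∀ A D → A + 1ℤ + D ≡ A + D + 1ℤ
    ring = solve-∀

  range-++ : ∀ a p q → range a (p ℕ.+ q) ≡ range a p ++ range (a + + p) q
  range-++ a zero q = cong (λ t → range t q) (sym (ℤP.+-identityʳ a))
  range-++ a (suc p) q = cong (a ∷_) (trans (range-++ (a + 1ℤ) p q) (cong (λ t → range (a + 1ℤ) p ++ range t q) (ring a (+ p))))
    where
    ring : ∀ A P → A + 1ℤ + P ≡ A + (1ℤ + P)
    ring = solve-∀

  ∈-range⁻ : ∀ a k {c} → c ∈ range a k → a ℤ.≤ c × c ℤ.< a + + k
  ∈-range⁻ a (suc k) (here refl) =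
    ℤP.≤-refl , subst (ℤ._< a + + suc k) (ℤP.+-identityʳ a) (ℤP.+-monoʳ-< a (ℤ.+<+ (ℕ.s≤s ℕ.z≤n)))
  ∈-range⁻ a (suc k) (there c∈) =
    let (lo , hi) = ∈-range⁻ (a + 1ℤ) k c∈ in
    ℤP.≤-trans (ℤP.i≤i+j a 1ℤ) lo , subst (_ ℤ.<_) (ring a (+ k)) hi
    where
    ring : ∀ A K → A + 1ℤ + K ≡ A + (1ℤ + K)
    ring = solve-∀

  ∈-range⁺ : ∀ a k {c} → a ℤ.≤ c → c ℤ.< a + + k → c ∈ range a k
  ∈-range⁺ a zero {c} a≤c c<a = ⊥-elim (ℤP.<-irrefl refl (ℤP.≤-<-trans a≤c (subst (c ℤ.<_) (ℤP.+-identityʳ a) c<a)))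
  ∈-range⁺ a (suc k) {c} a≤c c<a+k with a ℤ.≟ c
  ... | yes refl = here refl
  ... | no a≢c = there (∈-range⁺ (a + 1ℤ) k
                        (subst (ℤ._≤ c) (ℤP.+-comm 1ℤ a) (ℤP.i<j⇒suc[i]≤j (ℤP.≤∧≢⇒< a≤c a≢c)))
                        (subst (c ℤ.<_) (ring a (+ k)) c<a+k))
    where
    ring : ∀ A K → A + (1ℤ + K) ≡ A + 1ℤ + K
    ring = solve-∀

  Central : ℕ → ℤ → Set
  Central l c = 1ℤ ℤ.≤ c × c ℤ.≤ + l - 1ℤ

  IsColumn-mono : ∀ {M N l c} → M ℕ.≤ N → IsColumn M l c → IsColumn N l c
  IsColumn-mono {l = l} M≤N (lo , hi) =
    ℤP.≤-trans (ℤP.+-monoʳ-≤ 1ℤ (ℤP.neg-mono-≤ (ℤ.+≤+ M≤N))) lo ,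
    ℤP.≤-trans hi (ℤP.+-monoˡ-≤ -1ℤ (ℤP.+-monoʳ-≤ (+ l) (ℤ.+≤+ M≤N)))

  Central⇒IsColumn : ∀ {n l c} → Central l c → IsColumn n l c
  Central⇒IsColumn {n} {l} (lo , hi) =
    ℤP.≤-trans (ℤP.i≤j⇒i-k≤j (+ n) ℤP.≤-refl) lo ,
    ℤP.≤-trans hi (ℤP.+-monoˡ-≤ -1ℤ (ℤP.i≤i+j (+ l) (+ n)))

  -- Passing from an (n₁+n₂, l)-trapezoid to its top n₂ rows, read as an (n₂, l+2n₁)-trapezoid,
  -- moves column labels by n₁.
  IsColumn-lower : ∀ {j k l c} → IsColumn (j ℕ.+ k) l c → IsColumn j (l ℕ.+ 2 ℕ.* k) (c + + k)
  IsColumn-lower {j} {k} {l} {c} (lo , hi) = ≤-translate (+ k) lo-eq refl lo , ≤-translate (+ k) refl hi-eq hi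
    where
    lo-eq : 1ℤ - + (j ℕ.+ k) + + k ≡ 1ℤ - + j
    lo-eq = trans (cong (λ t → 1ℤ - t + + k) (ℤP.pos-+ j k)) (ring (+ j) (+ k))
      where
      ring : ∀ J K → 1ℤ - (J + K) + K ≡ 1ℤ - J
      ring = solve-∀
    hi-eq : + l + + (j ℕ.+ k) - 1ℤ + + k ≡ + (l ℕ.+ 2 ℕ.* k) + + j - 1ℤ
    hi-eq = trans (cong (λ t → + l + t - 1ℤ + + k) (ℤP.pos-+ j k))
      (trans (ring (+ l) (+ j) (+ k)) (cong (λ t → t + + j - 1ℤ) (sym (pos-+-2* l k))))
      where
      ring : ∀ L J K → L + (J + K) - 1ℤ + K ≡ L + K + K + J - 1ℤ
      ring = solve-∀

  IsColumn-raise : ∀ {j k l c} → IsColumn j (l ℕ.+ 2 ℕ.* k) c → IsColumn (j ℕ.+ k) l (c - + k)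
  IsColumn-raise {j} {k} {l} {c} (lo , hi) = ≤-translate (- + k) lo-eq refl lo , ≤-translate (- + k) refl hi-eq hi
    where
    lo-eq : 1ℤ - + j + - + k ≡ 1ℤ - + (j ℕ.+ k)
    lo-eq = trans (ring (+ j) (+ k)) (cong (λ t → 1ℤ - t) (sym (ℤP.pos-+ j k)))
      where
      ring : ∀ J K → 1ℤ - J + - K ≡ 1ℤ - (J + K)
      ring = solve-∀
    hi-eq : + (l ℕ.+ 2 ℕ.* k) + + j - 1ℤ + - + k ≡ + l + + (j ℕ.+ k) - 1ℤ
    hi-eq = trans (cong (λ t → t + + j - 1ℤ + - + k) (pos-+-2* l k))
      (trans (ring (+ l) (+ j) (+ k)) (cong (λ t → + l + t - 1ℤ) (sym (ℤP.pos-+ j k))))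
      where
      ring : ∀ L J K → L + K + K + J - 1ℤ + - K ≡ L + (J + K) - 1ℤ
      ring = solve-∀

  IsColumn-zero⇒Central : ∀ {l c} → IsColumn 0 l c → Central l c
  IsColumn-zero⇒Central {l} {c} (lo , hi) = lo , subst (λ b → c ℤ.≤ b - 1ℤ) (ℤP.+-identityʳ (+ l)) hi

  Central⇒IsColumn-zero : ∀ {l c} → Central l c → IsColumn 0 l c
  Central⇒IsColumn-zero {l} {c} (lo , hi) = lo , subst (λ b → c ℤ.≤ b - 1ℤ) (sym (ℤP.+-identityʳ (+ l))) hi

  InShape-stack : ∀ {n₁ n₂ l j c} → InShape n₂ (l ℕ.+ 2 ℕ.* n₁) j (c + + n₁) → InShape (n₂ ℕ.+ n₁) l (j ℕ.+ n₁) c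
  InShape-stack {n₁} {l = l} {j} {c} (1≤j , j≤n₂ , col) =
    ℕP.≤-trans 1≤j (ℕP.m≤m+n j n₁) , ℕP.+-monoˡ-≤ n₁ j≤n₂ ,
    subst (IsColumn (j ℕ.+ n₁) l) (i+j-j≡i c (+ n₁)) (IsColumn-raise {j} {n₁} {l} col)

  InShape-unstack : ∀ {n₁ n₂ l j c} → 1 ℕ.≤ j →
    InShape (n₂ ℕ.+ n₁) l (j ℕ.+ n₁) (c - + n₁) → InShape n₂ (l ℕ.+ 2 ℕ.* n₁) j c
  InShape-unstack {n₁} {n₂} {l} {j} {c} 1≤j (_ , j+n₁≤n , col) =
    1≤j , ℕP.+-cancelʳ-≤ n₁ j n₂ j+n₁≤n ,
    subst (IsColumn j (l ℕ.+ 2 ℕ.* n₁)) (i-j+j≡i c (+ n₁)) (IsColumn-lower {j} {n₁} {l} col)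

  Central-or-right : ∀ l c → 1ℤ ℤ.≤ c → Central l c ⊎ + l ℤ.≤ c
  Central-or-right l c 1≤c with c ℤP.≤? + l - 1ℤ
  ... | yes c≤l-1 = inj₁ (1≤c , c≤l-1)
  ... | no c≰l-1 =
    inj₂ (subst (ℤ._≤ c) (trans (ℤP.+-comm 1ℤ (+ l - 1ℤ)) (i-j+j≡i (+ l) 1ℤ)) (ℤP.i<j⇒suc[i]≤j (ℤP.≰⇒> c≰l-1)))

  -- The column through which a nonzero x enters 𝒮: the label x + 1 for x < 0 and x + (l - 1)
  -- for x > 0, inverting the two clauses of In𝒮. The value at 0 is junk.
  columnOf : ℕ → ℤ → ℤ
  columnOf l (+ zero) = 0ℤ
  columnOf l (+ suc m) = + suc m + (+ l - 1ℤ)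
  columnOf l -[1+ m ] = -[1+ m ] + 1ℤ

  columnOf-neg : ∀ l m → columnOf l -[1+ m ] ≡ - + m
  columnOf-neg l zero = refl
  columnOf-neg l (suc m) = refl

  IsColumn-columnOf⇒∣∣≤ : ∀ {n l} x → x ≢ 0ℤ → IsColumn n l (columnOf l x) → ℤ.∣ x ∣ ℕ.≤ n
  IsColumn-columnOf⇒∣∣≤ (+ zero) x≢0 _ = ⊥-elim (x≢0 refl)
  IsColumn-columnOf⇒∣∣≤ {n} {l} (+ suc m) _ (_ , hi) =
    ℤP.drop‿+≤+ (≤-translate (- (+ l - 1ℤ)) (ring₁ (+ suc m) (+ l)) (ring₂ (+ l) (+ n)) hi)
    where
    ring₁ : ∀ X L → X + (L - 1ℤ) + - (L - 1ℤ) ≡ X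
    ring₁ = solve-∀
    ring₂ : ∀ L N → L + N - 1ℤ + - (L - 1ℤ) ≡ N
    ring₂ = solve-∀
  IsColumn-columnOf⇒∣∣≤ {n} -[1+ m ] _ (lo , _) =
    ℤP.drop‿+≤+ (ℤP.neg-cancel-≤ (≤-translate -1ℤ (ring₁ (+ n)) (i+j-j≡i -[1+ m ] 1ℤ) lo))
    where
    ring₁ : ∀ N → 1ℤ - N + -1ℤ ≡ - N
    ring₁ = solve-∀

  ∣∣≤⇒IsColumn-columnOf : ∀ {n l} x → 1 ℕ.≤ l → x ≢ 0ℤ → ℤ.∣ x ∣ ℕ.≤ n → IsColumn n l (columnOf l x)
  ∣∣≤⇒IsColumn-columnOf (+ zero) _ x≢0 _ = ⊥-elim (x≢0 refl)
  ∣∣≤⇒IsColumn-columnOf {n} {suc l} (+ suc m) _ _ m<n =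
    ℤP.≤-trans (ℤP.i≤j⇒i-k≤j (+ n) ℤP.≤-refl) (ℤ.+≤+ (ℕ.s≤s ℕ.z≤n)) ,
    ≤-translate (+ suc l - 1ℤ) refl (ring (+ n) (+ l)) (ℤ.+≤+ m<n)
    where
    ring : ∀ N L → N + (1ℤ + L - 1ℤ) ≡ 1ℤ + L + N - 1ℤ
    ring = solve-∀
  ∣∣≤⇒IsColumn-columnOf {n} {suc l} -[1+ m ] _ _ m<n =
    ≤-translate 1ℤ (ring (+ n)) refl (ℤP.neg-mono-≤ (ℤ.+≤+ m<n)) ,
    subst (ℤ._≤ + suc l + + n - 1ℤ) (sym (columnOf-neg (suc l) m))
      (ℤP.≤-trans (ℤP.neg-mono-≤ (ℤ.+≤+ ℕ.z≤n)) (ℤ.+≤+ ℕ.z≤n))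
    where
    ring : ∀ N → - N + 1ℤ ≡ 1ℤ - N
    ring = solve-∀

  columnOf-injective : ∀ {l} x y → 1 ℕ.≤ l → x ≢ 0ℤ → y ≢ 0ℤ → columnOf l x ≡ columnOf l y → x ≡ y
  columnOf-injective (+ zero) _ _ x≢0 _ _ = ⊥-elim (x≢0 refl)
  columnOf-injective _ (+ zero) _ _ y≢0 _ = ⊥-elim (y≢0 refl)
  columnOf-injective {l} (+ suc m) (+ suc m′) _ _ _ eq = +-cancelʳ (+ l - 1ℤ) eq
  columnOf-injective -[1+ m ] -[1+ m′ ] _ _ _ eq = +-cancelʳ 1ℤ eq
  columnOf-injective {suc l} (+ suc m) -[1+ m′ ] _ _ _ eq =
    ⊥-elim (+[1+m]≢-n (trans eq (columnOf-neg (suc l) m′)))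
  columnOf-injective {suc l} -[1+ m ] (+ suc m′) _ _ _ eq =
    ⊥-elim (+[1+m]≢-n (trans (sym eq) (columnOf-neg (suc l) m)))

  columnOf-left : ∀ l c → c ℤ.≤ 0ℤ → c - 1ℤ ≢ 0ℤ × columnOf l (c - 1ℤ) ≡ c
  columnOf-left l (+ zero) _ = (λ ()) , refl
  columnOf-left l (+ suc k) (ℤ.+≤+ ())
  columnOf-left l -[1+ k ] _ = (λ ()) , cong -[1+_] (ℕP.+-identityʳ k)

  columnOf-right : ∀ l c → + l ℤ.≤ c → c - (+ l - 1ℤ) ≢ 0ℤ × columnOf l (c - (+ l - 1ℤ)) ≡ c
  columnOf-right l c l≤c with ≤⇒≡+ l≤c
  ... | d , refl = subst (λ x → x ≢ 0ℤ × columnOf l x ≡ + l + + d) (sym (ring₁ (+ l) (+ d))) ((λ ()) , ring₂ (+ l) (+ d))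
    where
    ring₁ : ∀ L D → L + D - (L - 1ℤ) ≡ 1ℤ + D
    ring₁ = solve-∀
    ring₂ : ∀ L D → 1ℤ + D + (L - 1ℤ) ≡ L + D
    ring₂ = solve-∀

  columnOf-cases : ∀ l x → 1 ℕ.≤ l → x ≢ 0ℤ →
    (columnOf l x ℤ.≤ 0ℤ × x ≡ columnOf l x - 1ℤ) ⊎ (1ℤ ℤ.≤ columnOf l x × x ≡ columnOf l x - (+ l - 1ℤ))
  columnOf-cases l (+ zero) _ x≢0 = ⊥-elim (x≢0 refl)
  columnOf-cases (suc l) (+ suc m) _ _ = inj₂ (ℤ.+≤+ (ℕ.s≤s ℕ.z≤n) , sym (i+j-j≡i (+ suc m) (+ suc l - 1ℤ)))
  columnOf-cases l -[1+ m ] _ _ =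
    inj₁ (subst (ℤ._≤ 0ℤ) (sym (columnOf-neg l m)) (ℤP.neg-mono-≤ (ℤ.+≤+ ℕ.z≤n)) , sym (i+j-j≡i -[1+ m ] 1ℤ))

  shift-neg : ∀ k m → shift k -[1+ m ] ≡ -[1+ m ℕ.+ k ]
  shift-neg zero m = cong -[1+_] (sym (ℕP.+-identityʳ m))
  shift-neg (suc k) m = cong -[1+_] (sym (ℕP.+-suc m k))

  ∣shift∣ : ∀ k y → y ≢ 0ℤ → ℤ.∣ shift k y ∣ ≡ ℤ.∣ y ∣ ℕ.+ k
  ∣shift∣ k (+ zero) y≢0 = ⊥-elim (y≢0 refl)
  ∣shift∣ k (+ suc m) _ = refl
  ∣shift∣ k -[1+ m ] _ = cong ℤ.∣_∣ (shift-neg k m)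

  k<∣shift∣ : ∀ k y → y ≢ 0ℤ → k ℕ.< ℤ.∣ shift k y ∣
  k<∣shift∣ k y y≢0 = subst (k ℕ.<_) (sym (∣shift∣ k y y≢0))
    (ℕP.+-monoˡ-≤ k (ℕP.n≢0⇒n>0 (λ ∣y∣≡0 → y≢0 (ℤP.∣i∣≡0⇒i≡0 ∣y∣≡0))))

  shift-≢0 : ∀ k y → y ≢ 0ℤ → shift k y ≢ 0ℤ
  shift-≢0 k (+ zero) y≢0 = ⊥-elim (y≢0 refl)
  shift-≢0 k (+ suc m) _ ()
  shift-≢0 k -[1+ m ] _ eq with trans (sym (shift-neg k m)) eq
  ... | ()

  shift-injective : ∀ k y y′ → shift k y ≡ shift k y′ → y ≡ y′
  shift-injective k (+ zero) (+ zero) _ = refl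
  shift-injective k (+ suc m) (+ suc m′) eq =
    cong (λ t → + suc t) (ℕP.+-cancelʳ-≡ k m m′ (ℕP.suc-injective (ℤP.+-injective eq)))
  shift-injective k -[1+ m ] -[1+ m′ ] eq =
    cong -[1+_] (ℕP.+-cancelʳ-≡ k m m′ (ℤP.-[1+-injective (trans (sym (shift-neg k m)) (trans eq (shift-neg k m′)))))
  shift-injective k (+ zero) (+ suc m′) ()
  shift-injective k (+ suc m) (+ zero) ()
  shift-injective k (+ _) -[1+ m′ ] eq with trans eq (shift-neg k m′)
  shift-injective k (+ zero) -[1+ m′ ] eq | ()
  shift-injective k (+ suc m) -[1+ m′ ] eq | ()
  shift-injective k -[1+ m ] (+ _) eq with trans (sym eq) (shift-neg k m)
  shift-injective k -[1+ m ] (+ zero) eq | ()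
  shift-injective k -[1+ m ] (+ suc m′) eq | ()

  shift-surjective : ∀ k x → x ≢ 0ℤ → k ℕ.< ℤ.∣ x ∣ → Σ ℤ λ y → y ≢ 0ℤ × shift k y ≡ x
  shift-surjective k (+ zero) x≢0 _ = ⊥-elim (x≢0 refl)
  shift-surjective k (+ suc m) _ k≤m with ℕP.m≤n⇒∃[o]m+o≡n (ℕP.≤-pred k≤m)
  ... | d , refl = + suc d , (λ ()) , cong (λ t → + suc t) (ℕP.+-comm d k)
  shift-surjective k -[1+ m ] _ k≤m with ℕP.m≤n⇒∃[o]m+o≡n (ℕP.≤-pred k≤m)
  ... | d , refl = -[1+ d ] , (λ ()) , trans (shift-neg k d) (cong -[1+_] (ℕP.+-comm d k))

  columnOf-shift : ∀ l k y → y ≢ 0ℤ → columnOf l (shift k y) ≡ columnOf (l ℕ.+ 2 ℕ.* k) y - + k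
  columnOf-shift l k (+ zero) y≢0 = ⊥-elim (y≢0 refl)
  columnOf-shift l k (+ suc m) _ =
    trans (cong (λ t → 1ℤ + t + (+ l - 1ℤ)) (ℤP.pos-+ m k))
      (trans (ring (+ m) (+ k) (+ l)) (cong (λ t → 1ℤ + + m + (t - 1ℤ) - + k) (sym (pos-+-2* l k))))
    where
    ring : ∀ M K L → 1ℤ + (M + K) + (L - 1ℤ) ≡ 1ℤ + M + (L + K + K - 1ℤ) - K
    ring = solve-∀
  columnOf-shift l k -[1+ m ] _ = begin
    columnOf l (shift k -[1+ m ])        ≡⟨ cong (columnOf l) (shift-neg k m) ⟩
    columnOf l -[1+ m ℕ.+ k ]            ≡⟨ columnOf-neg l (m ℕ.+ k) ⟩
    - + (m ℕ.+ k)                        ≡⟨ cong -_ (ℤP.pos-+ m k) ⟩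
    - (+ m + + k)                        ≡⟨ ring (+ m) (+ k) ⟩
    - + m - + k                          ≡⟨ cong (λ t → t - + k) (sym (columnOf-neg (l ℕ.+ 2 ℕ.* k) m)) ⟩
    columnOf (l ℕ.+ 2 ℕ.* k) -[1+ m ] - + k ∎
    where
    open ≡-Reasoning
    ring : ∀ M K → - (M + K) ≡ - M - K
    ring = solve-∀

  columnOf-shift-outside : ∀ {k l} y → y ≢ 0ℤ → ¬ IsColumn k l (columnOf l (shift k y))
  columnOf-shift-outside {k} y y≢0 col =
    ℕP.<⇒≱ (k<∣shift∣ k y y≢0) (IsColumn-columnOf⇒∣∣≤ (shift k y) (shift-≢0 k y y≢0) col)

  columnOf-shift-+ : ∀ l k y → y ≢ 0ℤ → columnOf l (shift k y) + + k ≡ columnOf (l ℕ.+ 2 ℕ.* k) y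
  columnOf-shift-+ l k y y≢0 = trans (cong (_+ + k) (columnOf-shift l k y y≢0)) (i-j+j≡i _ (+ k))

  dropRows : ℕ → Array → Array
  dropRows k A i = A (i ℕ.+ k)

  All-rowsTopDown : ∀ k {P : ℕ → Set} → (∀ i → 1 ℕ.≤ i → i ℕ.≤ k → P i) → All P (rowsTopDown k)
  All-rowsTopDown zero _ = []
  All-rowsTopDown (suc k) p =
    p (suc k) (ℕ.s≤s ℕ.z≤n) ℕP.≤-refl ∷ All-rowsTopDown k (λ i 1≤i i≤k → p i 1≤i (ℕP.m≤n⇒m≤1+n i≤k))

  map-rowsTopDown-cong : ∀ k {f g : ℕ → ℤ} → (∀ i → 1 ℕ.≤ i → i ℕ.≤ k → f i ≡ g i) →
    map f (rowsTopDown k) ≡ map g (rowsTopDown k)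
  map-rowsTopDown-cong zero _ = refl
  map-rowsTopDown-cong (suc k) f≗g =
    cong₂ _∷_ (f≗g (suc k) (ℕ.s≤s ℕ.z≤n) ℕP.≤-refl)
              (map-rowsTopDown-cong k (λ i 1≤i i≤k → f≗g i 1≤i (ℕP.m≤n⇒m≤1+n i≤k)))

  rowsTopDown-+ : ∀ k n → rowsTopDown (k ℕ.+ n) ≡ map (ℕ._+ n) (rowsTopDown k) ++ rowsTopDown n
  rowsTopDown-+ zero n = refl
  rowsTopDown-+ (suc k) n = cong (suc (k ℕ.+ n) ∷_) (rowsTopDown-+ k n)

  colList-+ : ∀ k n A c → colList (k ℕ.+ n) A c ≡ colList k (dropRows n A) c ++ colList n A c
  colList-+ k n A c = begin
    map (λ i → A i c) (rowsTopDown (k ℕ.+ n))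
      ≡⟨ cong (map (λ i → A i c)) (rowsTopDown-+ k n) ⟩
    map (λ i → A i c) (map (ℕ._+ n) (rowsTopDown k) ++ rowsTopDown n)
      ≡⟨ ListP.map-++ (λ i → A i c) (map (ℕ._+ n) (rowsTopDown k)) (rowsTopDown n) ⟩
    map (λ i → A i c) (map (ℕ._+ n) (rowsTopDown k)) ++ colList n A c
      ≡⟨ cong (_++ colList n A c) (sym (ListP.map-∘ (rowsTopDown k))) ⟩
    colList k (dropRows n A) c ++ colList n A c ∎
    where open ≡-Reasoning

  colSum-+ : ∀ k n A c → colSum (k ℕ.+ n) A c ≡ colSum k (dropRows n A) c + colSum n A c
  colSum-+ k n A c = trans (cong sumℤ (colList-+ k n A c)) (sumℤ-++ (colList k (dropRows n A) c) (colList n A c))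

  row-above : ∀ k i → ¬ i ℕ.≤ k → Σ ℕ λ j → 1 ℕ.≤ j × j ℕ.+ k ≡ i
  row-above k i i≰k with ℕP.m≤n⇒∃[o]m+o≡n (ℕP.≰⇒> i≰k)
  ... | o , refl = suc o , ℕ.s≤s ℕ.z≤n , cong suc (ℕP.+-comm o k)

  sumℤ-ones : ∀ k → sumℤ (map (λ _ → 1ℤ) (rowsTopDown k)) ≡ + k
  sumℤ-ones zero = refl
  sumℤ-ones (suc k) = cong (λ s → 1ℤ + s) (sumℤ-ones k)

  stack-below : ∀ {n₁ A₁ A₂ i c} → i ℕ.≤ n₁ → stack n₁ A₁ A₂ i c ≡ A₁ i c
  stack-below {n₁} {i = i} i≤n₁ with i ℕ.≤ᵇ n₁ | ℕP.≤⇒≤ᵇ i≤n₁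
  ... | true | _ = refl

  stack-above : ∀ {n₁ A₁ A₂ j c} → 1 ℕ.≤ j → stack n₁ A₁ A₂ (j ℕ.+ n₁) c ≡ A₂ j (c + + n₁)
  stack-above {n₁} {A₂ = A₂} {j} {c} 1≤j with (j ℕ.+ n₁) ℕ.≤ᵇ n₁ in eq
  ... | true = ⊥-elim (ℕP.<⇒≱ (ℕP.+-monoˡ-≤ n₁ 1≤j) (ℕP.≤ᵇ⇒≤ (j ℕ.+ n₁) n₁ (subst T (sym eq) tt)))
  ... | false = cong (λ t → A₂ t (c + + n₁)) (ℕP.m+n∸n≡m j n₁)

  bottomRows-below : ∀ {n₁ A i c} → i ℕ.≤ n₁ → bottomRows n₁ A i c ≡ A i c
  bottomRows-below {n₁} {i = i} i≤n₁ with i ℕ.≤ᵇ n₁ | ℕP.≤⇒≤ᵇ i≤n₁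
  ... | true | _ = refl

  colList-stack : ∀ n₂ n₁ A₁ A₂ c →
    colList (n₂ ℕ.+ n₁) (stack n₁ A₁ A₂) c ≡ colList n₂ A₂ (c + + n₁) ++ colList n₁ A₁ c
  colList-stack n₂ n₁ A₁ A₂ c = trans (colList-+ n₂ n₁ (stack n₁ A₁ A₂) c)
    (cong₂ _++_ (map-rowsTopDown-cong n₂ (λ j 1≤j _ → stack-above {n₁} {A₁} {A₂} 1≤j))
                (map-rowsTopDown-cong n₁ (λ i _ i≤n₁ → stack-below {n₁} {A₁} {A₂} i≤n₁)))

  colList-bottomRows : ∀ n₁ A c → colList n₁ (bottomRows n₁ A) c ≡ colList n₁ A c
  colList-bottomRows n₁ A c = map-rowsTopDown-cong n₁ (λ i _ i≤n₁ → bottomRows-below {n₁} {A} i≤n₁)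

  colList-topRows : ∀ k n₁ A c → colList k (topRows n₁ A) c ≡ colList k (dropRows n₁ A) (c - + n₁)
  colList-topRows k n₁ A c = map-rowsTopDown-cong k topRows-pos
    where
    topRows-pos : ∀ i → 1 ℕ.≤ i → i ℕ.≤ k → topRows n₁ A i c ≡ A (i ℕ.+ n₁) (c - + n₁)
    topRows-pos (suc i) _ _ = refl

  rowLength-+ : ∀ l j n₁ → l ℕ.+ 2 ℕ.* (j ℕ.+ n₁) ℕ.∸ 1 ≡ (l ℕ.+ 2 ℕ.* n₁) ℕ.+ 2 ℕ.* j ℕ.∸ 1
  rowLength-+ l j n₁ = cong (ℕ._∸ 1) (ring l j n₁)
    where
    ring : ∀ l j n → l ℕ.+ 2 ℕ.* (j ℕ.+ n) ≡ (l ℕ.+ 2 ℕ.* n) ℕ.+ 2 ℕ.* j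
    ring = ℕSolver.solve-∀

  rowList-stack-below : ∀ l n₁ A₁ A₂ i → i ℕ.≤ n₁ → rowList l (stack n₁ A₁ A₂) i ≡ rowList l A₁ i
  rowList-stack-below l n₁ A₁ A₂ i i≤n₁ = ListP.map-cong (λ c → stack-below {n₁} {A₁} {A₂} {i} {c} i≤n₁) _

  rowList-bottomRows : ∀ l n₁ A i → i ℕ.≤ n₁ → rowList l (bottomRows n₁ A) i ≡ rowList l A i
  rowList-bottomRows l n₁ A i i≤n₁ = ListP.map-cong (λ c → bottomRows-below {n₁} {A} {i} {c} i≤n₁) _

  rowList-stack-above : ∀ l n₁ A₁ A₂ j → 1 ℕ.≤ j →
    rowList l (stack n₁ A₁ A₂) (j ℕ.+ n₁) ≡ rowList (l ℕ.+ 2 ℕ.* n₁) A₂ j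
  rowList-stack-above l n₁ A₁ A₂ j 1≤j = begin
    map (stack n₁ A₁ A₂ (j ℕ.+ n₁)) (range (1ℤ - + (j ℕ.+ n₁)) len)
      ≡⟨ ListP.map-cong (λ c → stack-above {n₁} {A₁} {A₂} {j} {c} 1≤j) _ ⟩
    map (A₂ j ∘ (_+ + n₁)) (range (1ℤ - + (j ℕ.+ n₁)) len)
      ≡⟨ ListP.map-∘ (range (1ℤ - + (j ℕ.+ n₁)) len) ⟩
    map (A₂ j) (map (_+ + n₁) (range (1ℤ - + (j ℕ.+ n₁)) len))
      ≡⟨ cong (map (A₂ j)) (range-translate _ (+ n₁) len) ⟩
    map (A₂ j) (range (1ℤ - + (j ℕ.+ n₁) + + n₁) len)
      ≡⟨ cong₂ (λ a k → map (A₂ j) (range a k)) start (rowLength-+ l j n₁) ⟩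
    rowList (l ℕ.+ 2 ℕ.* n₁) A₂ j ∎
    where
    open ≡-Reasoning
    len : ℕ
    len = l ℕ.+ 2 ℕ.* (j ℕ.+ n₁) ℕ.∸ 1
    start : 1ℤ - + (j ℕ.+ n₁) + + n₁ ≡ 1ℤ - + j
    start = trans (cong (λ t → 1ℤ - t + + n₁) (ℤP.pos-+ j n₁)) (ring (+ j) (+ n₁))
      where
      ring : ∀ J N → 1ℤ - (J + N) + N ≡ 1ℤ - J
      ring = solve-∀

  rowList-topRows : ∀ l n₁ A j → 1 ℕ.≤ j → rowList (l ℕ.+ 2 ℕ.* n₁) (topRows n₁ A) j ≡ rowList l A (j ℕ.+ n₁)
  rowList-topRows l n₁ A (suc j) _ = begin
    map (A (suc j ℕ.+ n₁) ∘ (_- + n₁)) (range (1ℤ - + suc j) len)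
      ≡⟨ ListP.map-∘ (range (1ℤ - + suc j) len) ⟩
    map (A (suc j ℕ.+ n₁)) (map (_+ - + n₁) (range (1ℤ - + suc j) len))
      ≡⟨ cong (map (A (suc j ℕ.+ n₁))) (range-translate _ (- + n₁) len) ⟩
    map (A (suc j ℕ.+ n₁)) (range (1ℤ - + suc j + - + n₁) len)
      ≡⟨ cong₂ (λ a k → map (A (suc j ℕ.+ n₁)) (range a k)) start (sym (rowLength-+ l (suc j) n₁)) ⟩
    rowList l A (suc j ℕ.+ n₁) ∎
    where
    open ≡-Reasoning
    len : ℕ
    len = (l ℕ.+ 2 ℕ.* n₁) ℕ.+ 2 ℕ.* suc j ℕ.∸ 1
    start : 1ℤ - + suc j + - + n₁ ≡ 1ℤ - + (suc j ℕ.+ n₁)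
    start = trans (ring (+ suc j) (+ n₁)) (cong (λ t → 1ℤ - t) (sym (ℤP.pos-+ (suc j) n₁)))
      where
      ring : ∀ J N → 1ℤ - J + - N ≡ 1ℤ - (J + N)
      ring = solve-∀

  IsColumn? : ∀ n l c → Dec (IsColumn n l c)
  IsColumn? n l c = ((1ℤ - + n) ℤP.≤? c) ×-dec (c ℤP.≤? (+ l + + n - 1ℤ))

  entry-outside-zero : ∀ {n l A i c} → IsASTrapezoid n l A → ¬ IsColumn i l c → A i c ≡ 0ℤ
  entry-outside-zero {A = A} {i} {c} T ¬col with A i c ℤ.≟ 0ℤ
  ... | yes eq = eq
  ... | no neq = ⊥-elim (¬col (proj₂ (proj₂ (IsASTrapezoid.support T i c neq))))

  colList-outside-zeros : ∀ {n l A} → IsASTrapezoid n l A → ∀ k c → ¬ IsColumn k l c → All (_≡ 0ℤ) (colList k A c)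
  colList-outside-zeros {l = l} {A} T k c ¬col = AllP.map⁺ (All-rowsTopDown k entry-zero)
    where
    entry-zero : ∀ i → 1 ℕ.≤ i → i ℕ.≤ k → A i c ≡ 0ℤ
    entry-zero i _ i≤k = entry-outside-zero T (λ col → ¬col (IsColumn-mono {l = l} i≤k col))

  colSum-outside-zero : ∀ {n l A} → IsASTrapezoid n l A → ∀ k c → ¬ IsColumn k l c → colSum k A c ≡ 0ℤ
  colSum-outside-zero T k c ¬col = sumℤ-zeros (colList-outside-zeros T k c ¬col)

  colList-entries : ∀ {n l A} → IsASTrapezoid n l A → ∀ k c → All IsEntry (colList k A c)
  colList-entries T k c = AllP.map⁺ (All-rowsTopDown k (λ i _ _ → IsASTrapezoid.entries T i c))

  column-Walk01 : ∀ {n l A} → IsASTrapezoid n l A → ∀ c → Walk01 false (colList n A c)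
  column-Walk01 {n} {l} T c with IsColumn? n l c
  ... | yes col = Alternating⇒Walk01 _ (colList-entries T n c) (IsASTrapezoid.colAlt T c col) (IsASTrapezoid.colFirst T c col)
  ... | no ¬col = Walk01-zeros (colList-outside-zeros T n c ¬col)

  colSum-pos⇒≡1 : ∀ {n l A} → IsASTrapezoid n l A → ∀ c → 0ℤ ℤ.< colSum n A c → colSum n A c ≡ 1ℤ
  colSum-pos⇒≡1 T c pos with Walk01-sum01 (column-Walk01 T c)
  ... | inj₁ eq = ⊥-elim (ℤP.<-irrefl (sym eq) pos)
  ... | inj₂ eq = eq

  -- range (1 - n) (l + 2n - 1) lists all column labels of an (n, l)-trapezoid.
  rowList-window : ∀ {n l A} → IsASTrapezoid n l A → ∀ i → 1 ℕ.≤ i → i ℕ.≤ n →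
    sumℤ (map (A i) (range (1ℤ - + n) (l ℕ.+ 2 ℕ.* n ℕ.∸ 1))) ≡ sumℤ (rowList l A i)
  rowList-window {l = l} {A} T i 1≤i i≤n
    with ℕP.m≤n⇒∃[o]m+o≡n i≤n | ℕP.m≤n⇒∃[o]m+o≡n (ℕP.≤-trans 1≤i (ℕP.m≤n+m i (l ℕ.+ i)))
  ... | d , refl | r , 1+r≡ = begin
    Σr a (l ℕ.+ 2 ℕ.* (i ℕ.+ d) ℕ.∸ 1)            ≡⟨ cong (Σr a) window-length ⟩
    Σr a (d ℕ.+ (r ℕ.+ d))                         ≡⟨ Σr-++ a d (r ℕ.+ d) ⟩
    Σr a d + Σr (a + + d) (r ℕ.+ d)                ≡⟨ cong (λ t → Σr a d + t) (Σr-++ (a + + d) r d) ⟩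
    Σr a d + (Σr (a + + d) r + Σr (a + + d + + r) d) ≡⟨ cong₂ (λ s t → s + (Σr (a + + d) r + t)) left-zero right-zero ⟩
    0ℤ + (Σr (a + + d) r + 0ℤ)                     ≡⟨ trans (ℤP.+-identityˡ _) (ℤP.+-identityʳ _) ⟩
    Σr (a + + d) r                                 ≡⟨ cong₂ Σr start row-length ⟩
    sumℤ (rowList l A i)                           ∎
    where
    open ≡-Reasoning
    Σr : ℤ → ℕ → ℤ
    Σr b k = sumℤ (map (A i) (range b k))
    Σr-++ : ∀ b p q → Σr b (p ℕ.+ q) ≡ Σr b p + Σr (b + + p) q
    Σr-++ b p q = trans (cong (λ cs → sumℤ (map (A i) cs)) (range-++ b p q)) (sumℤ-map-++ (A i) (range b p) _)
    Σr-zero : ∀ b k → (∀ {c} → c ∈ range b k → ¬ IsColumn i l c) → Σr b k ≡ 0ℤ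
    Σr-zero b k outside = sumℤ-zeros (AllP.map⁺ (All.tabulate (λ c∈ → entry-outside-zero T (outside c∈))))
    a : ℤ
    a = 1ℤ - + (i ℕ.+ d)
    start : a + + d ≡ 1ℤ - + i
    start = trans (cong (λ t → 1ℤ - t + + d) (ℤP.pos-+ i d)) (ring (+ i) (+ d))
      where
      ring : ∀ I D → 1ℤ - (I + D) + D ≡ 1ℤ - I
      ring = solve-∀
    window-length : l ℕ.+ 2 ℕ.* (i ℕ.+ d) ℕ.∸ 1 ≡ d ℕ.+ (r ℕ.+ d)
    window-length = trans (cong (ℕ._∸ 1) (trans (ring₁ l i d) (cong (ℕ._+ 2 ℕ.* d) (sym 1+r≡)))) (ring₂ r d)
      where
      ring₁ : ∀ l i d → l ℕ.+ 2 ℕ.* (i ℕ.+ d) ≡ (l ℕ.+ i) ℕ.+ i ℕ.+ 2 ℕ.* d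
      ring₁ = ℕSolver.solve-∀
      ring₂ : ∀ r d → r ℕ.+ 2 ℕ.* d ≡ d ℕ.+ (r ℕ.+ d)
      ring₂ = ℕSolver.solve-∀
    row-length : r ≡ l ℕ.+ 2 ℕ.* i ℕ.∸ 1
    row-length = cong (ℕ._∸ 1) (trans 1+r≡ (ring l i))
      where
      ring : ∀ l i → l ℕ.+ i ℕ.+ i ≡ l ℕ.+ 2 ℕ.* i
      ring = ℕSolver.solve-∀
    end : a + + d + + r ≡ + l + + i
    end = trans (cong₂ _+_ start (trans (ring₁ (+ r)) (cong (_- 1ℤ) (cong +_ 1+r≡))))
            (trans (cong (λ t → 1ℤ - + i + (t - 1ℤ)) (trans (ℤP.pos-+ (l ℕ.+ i) i) (cong (_+ + i) (ℤP.pos-+ l i))))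
                   (ring₂ (+ l) (+ i)))
      where
      ring₁ : ∀ R → R ≡ 1ℤ + R - 1ℤ
      ring₁ = solve-∀
      ring₂ : ∀ L I → 1ℤ - I + (L + I + I - 1ℤ) ≡ L + I
      ring₂ = solve-∀
    left-zero : Σr a d ≡ 0ℤ
    left-zero = Σr-zero a d λ c∈ (lo , _) →
      ℤP.<-irrefl refl (ℤP.<-≤-trans (subst (_ ℤ.<_) start (proj₂ (∈-range⁻ a d c∈))) lo)
    right-zero : Σr (a + + d + + r) d ≡ 0ℤ
    right-zero = Σr-zero _ d λ c∈ (_ , hi) →
      ℤP.<-irrefl refl (ℤP.≤-<-trans (subst (ℤ._≤ _) end (proj₁ (∈-range⁻ _ d c∈))) (ℤP.≤-<-trans hi (i-1<i (+ l + + i))))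

  IsColumn⇒∈-window : ∀ {n l c} → 1 ℕ.≤ l → IsColumn n l c → c ∈ range (1ℤ - + n) (l ℕ.+ 2 ℕ.* n ℕ.∸ 1)
  IsColumn⇒∈-window {n} {suc l} {c} _ (lo , hi) =
    ∈-range⁺ (1ℤ - + n) (suc l ℕ.+ 2 ℕ.* n ℕ.∸ 1) lo (ℤP.≤-<-trans hi (subst (+ suc l + + n - 1ℤ ℤ.<_) end (i-1<i _)))
    where
    end : + suc l + + n ≡ 1ℤ - + n + + (l ℕ.+ 2 ℕ.* n)
    end = trans (ring (+ l) (+ n)) (cong (λ t → 1ℤ - + n + t) (sym (pos-+-2* l n)))
      where
      ring : ∀ L N → 1ℤ + L + N ≡ 1ℤ - N + (L + N + N)
      ring = solve-∀

  -- x ∈ 𝒮(A), read off the column through which x enters 𝒮(A).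
  In𝒮ᶜ : ℕ → ℕ → Array → ℤ → Set
  In𝒮ᶜ n l A x = x ≡ 0ℤ ⊎ (x ≢ 0ℤ × ℤ.∣ x ∣ ℕ.≤ n × colSum n A (columnOf l x) ≡ 1ℤ)

  In𝒮ᶜ-through : ∀ {n l A x} c → IsASTrapezoid n l A → IsColumn n l c → 0ℤ ℤ.< colSum n A c →
    x ≢ 0ℤ × columnOf l x ≡ c → In𝒮ᶜ n l A x
  In𝒮ᶜ-through {n} {l} {A} {x} c T col pos (x≢0 , refl) =
    inj₂ (x≢0 , IsColumn-columnOf⇒∣∣≤ x x≢0 col , colSum-pos⇒≡1 T (columnOf l x) pos)

  In𝒮⇒In𝒮ᶜ : ∀ {n l A x} → IsASTrapezoid n l A → In𝒮 n l A x → In𝒮ᶜ n l A x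
  In𝒮⇒In𝒮ᶜ T (inj₁ x≡0) = inj₁ x≡0
  In𝒮⇒In𝒮ᶜ {l = l} T (inj₂ (inj₁ (c , col , c≤0 , pos , refl))) = In𝒮ᶜ-through c T col pos (columnOf-left l c c≤0)
  In𝒮⇒In𝒮ᶜ {l = l} T (inj₂ (inj₂ (c , col , 1≤c , pos , refl))) with Central-or-right l c 1≤c
  ... | inj₁ (lo , hi) = ⊥-elim (ℤP.<-irrefl (sym (IsASTrapezoid.central T c lo hi)) pos)
  ... | inj₂ l≤c = In𝒮ᶜ-through c T col pos (columnOf-right l c l≤c)

  In𝒮ᶜ⇒In𝒮 : ∀ {n l A x} → 1 ℕ.≤ l → In𝒮ᶜ n l A x → In𝒮 n l A x
  In𝒮ᶜ⇒In𝒮 _ (inj₁ x≡0) = inj₁ x≡0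
  In𝒮ᶜ⇒In𝒮 {n} {l} {A} {x} 1≤l (inj₂ (x≢0 , ∣x∣≤n , sum≡1)) =
    inj₂ (Sum.map (λ (c≤0 , eq) → columnOf l x , col , c≤0 , pos , eq) (λ (1≤c , eq) → columnOf l x , col , 1≤c , pos , eq)
                  (columnOf-cases l x 1≤l x≢0))
    where
    col : IsColumn n l (columnOf l x)
    col = ∣∣≤⇒IsColumn-columnOf x 1≤l x≢0 ∣x∣≤n
    pos : 0ℤ ℤ.< colSum n A (columnOf l x)
    pos = subst (0ℤ ℤ.<_) (sym sum≡1) (ℤ.+<+ (ℕ.s≤s ℕ.z≤n))

  In𝒮ᶜ⇒∈ : ∀ {n l A S x} → 1 ℕ.≤ l → 𝒮≡ n l A S → In𝒮ᶜ n l A x → x ∈ S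
  In𝒮ᶜ⇒∈ {x = x} 1≤l 𝒮A≡S inS = Equivalence.to (𝒮A≡S x) (In𝒮ᶜ⇒In𝒮 1≤l inS)

  ∈⇒In𝒮ᶜ : ∀ {n l A S x} → IsASTrapezoid n l A → 𝒮≡ n l A S → x ∈ S → In𝒮ᶜ n l A x
  ∈⇒In𝒮ᶜ {x = x} T 𝒮A≡S x∈S = In𝒮⇒In𝒮ᶜ T (Equivalence.from (𝒮A≡S x) x∈S)

  𝒮≡-intro : ∀ {n l A S} → 1 ℕ.≤ l → IsASTrapezoid n l A →
    (∀ x → In𝒮ᶜ n l A x → x ∈ S) → (∀ x → x ∈ S → In𝒮ᶜ n l A x) → 𝒮≡ n l A S
  𝒮≡-intro 1≤l T sound complete x =
    mk⇔ (λ inS → sound x (In𝒮⇒In𝒮ᶜ T inS)) (λ x∈S → In𝒮ᶜ⇒In𝒮 1≤l (complete x x∈S))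

  -- Stacking and splitting

  record IsShiftedUnion (k : ℕ) (S₁ S₂ S : List ℤ) : Set where
    field
      ∈⁻ : ∀ {x} → x ∈ S → x ∈ S₁ ⊎ x ∈ map (shift k) S₂
      ∈⁺ˡ : ∀ {x} → x ∈ S₁ → x ∈ S
      ∈⁺ʳ : ∀ {y} → y ∈ S₂ → shift k y ∈ S

  ∘ₛ-IsShiftedUnion : ∀ S₁ S₂ → IsShiftedUnion (length S₁ ℕ.∸ 1) S₁ S₂ (S₁ ∘ₛ S₂)
  ∘ₛ-IsShiftedUnion S₁ S₂ = record
    { ∈⁻ = λ x∈S → ∈-++⁻ S₁ (∈-deduplicate⁻ ℤ._≟_ (S₁ ++ map (shift k) S₂) x∈S)
    ; ∈⁺ˡ = λ x∈S₁ → ∈-deduplicate⁺ ℤ._≟_ (∈-++⁺ˡ x∈S₁)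
    ; ∈⁺ʳ = λ y∈S₂ → ∈-deduplicate⁺ ℤ._≟_ (∈-++⁺ʳ S₁ (∈-map⁺ (shift k) y∈S₂))
    }
    where
    k : ℕ
    k = length S₁ ℕ.∸ 1

  module Stacking {l n₁ n₂ A₁ A₂} (T₁ : IsASTrapezoid n₁ l A₁) (T₂ : IsASTrapezoid n₂ (l ℕ.+ 2 ℕ.* n₁) A₂) where

    B : Array
    B = stack n₁ A₁ A₂

    colSum-stack : ∀ c → colSum (n₂ ℕ.+ n₁) B c ≡ colSum n₂ A₂ (c + + n₁) + colSum n₁ A₁ c
    colSum-stack c = trans (cong sumℤ (colList-stack n₂ n₁ A₁ A₂ c)) (sumℤ-++ (colList n₂ A₂ (c + + n₁)) (colList n₁ A₁ c))

    -- c + n₁ is a central column of A₂.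
    colSum-above-A₁ : ∀ c → IsColumn n₁ l c → colSum n₂ A₂ (c + + n₁) ≡ 0ℤ
    colSum-above-A₁ c col =
      let (lo , hi) = IsColumn-zero⇒Central {l ℕ.+ 2 ℕ.* n₁} (IsColumn-lower {0} {n₁} {l} col)
      in IsASTrapezoid.central T₂ (c + + n₁) lo hi

    colSum-stack-inner : ∀ c → IsColumn n₁ l c → colSum (n₂ ℕ.+ n₁) B c ≡ colSum n₁ A₁ c
    colSum-stack-inner c col = trans (colSum-stack c) (trans (cong (_+ colSum n₁ A₁ c) (colSum-above-A₁ c col)) (ℤP.+-identityˡ _))

    colSum-stack-outer : ∀ c → ¬ IsColumn n₁ l c → colSum (n₂ ℕ.+ n₁) B c ≡ colSum n₂ A₂ (c + + n₁)
    colSum-stack-outer c ¬col =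
      trans (colSum-stack c)
        (trans (cong (λ t → colSum n₂ A₂ (c + + n₁) + t) (colSum-outside-zero T₁ n₁ c ¬col)) (ℤP.+-identityʳ _))

    column-stack-Walk01 : ∀ c → Walk01 false (colList (n₂ ℕ.+ n₁) B c)
    column-stack-Walk01 c with IsColumn? n₁ l c
    ... | yes col = subst (Walk01 false) (sym (colList-stack n₂ n₁ A₁ A₂ c))
          (Walk01-++-balanced (column-Walk01 T₂ (c + + n₁)) (colSum-above-A₁ c col) (column-Walk01 T₁ c))
    ... | no ¬col = subst (Walk01 false) (sym (colList-stack n₂ n₁ A₁ A₂ c))
          (Walk01-++ (column-Walk01 T₂ (c + + n₁)) (Walk01-zeros (colList-outside-zeros T₁ n₁ c ¬col)))

    stack-entries : ∀ i c → IsEntry (B i c)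
    stack-entries i c with i ℕ.≤ᵇ n₁
    ... | true = IsASTrapezoid.entries T₁ i c
    ... | false = IsASTrapezoid.entries T₂ (i ℕ.∸ n₁) (c + + n₁)

    stack-support : ∀ i c → B i c ≢ 0ℤ → InShape (n₂ ℕ.+ n₁) l i c
    stack-support i c B≢0 with i ℕ.≤? n₁
    ... | yes i≤n₁ =
      let (1≤i , _ , col) = IsASTrapezoid.support T₁ i c (subst (_≢ 0ℤ) (stack-below {n₁} {A₁} {A₂} i≤n₁) B≢0)
      in 1≤i , ℕP.≤-trans i≤n₁ (ℕP.m≤n+m n₁ n₂) , col
    ... | no i≰n₁ with row-above n₁ i i≰n₁
    ... | j , 1≤j , refl =
      InShape-stack {n₁} {n₂} {l}
        (IsASTrapezoid.support T₂ j (c + + n₁) (subst (_≢ 0ℤ) (stack-above {n₁} {A₁} {A₂} 1≤j) B≢0))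

    stack-rows : (P : List ℤ → Set) → (∀ i → 1 ℕ.≤ i → i ℕ.≤ n₁ → P (rowList l A₁ i)) →
      (∀ j → 1 ℕ.≤ j → j ℕ.≤ n₂ → P (rowList (l ℕ.+ 2 ℕ.* n₁) A₂ j)) →
      ∀ i → 1 ℕ.≤ i → i ℕ.≤ n₂ ℕ.+ n₁ → P (rowList l B i)
    stack-rows P below above i 1≤i i≤n with i ℕ.≤? n₁
    ... | yes i≤n₁ = subst P (sym (rowList-stack-below l n₁ A₁ A₂ i i≤n₁)) (below i 1≤i i≤n₁)
    ... | no i≰n₁ with row-above n₁ i i≰n₁
    ... | j , 1≤j , refl = subst P (sym (rowList-stack-above l n₁ A₁ A₂ j 1≤j)) (above j 1≤j (ℕP.+-cancelʳ-≤ n₁ j n₂ i≤n))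

    stack-IsASTrapezoid : IsASTrapezoid (n₂ ℕ.+ n₁) l B
    stack-IsASTrapezoid = record
      { entries = stack-entries
      ; support = stack-support
      ; rowSums = stack-rows (λ r → sumℤ r ≡ 1ℤ) (IsASTrapezoid.rowSums T₁) (IsASTrapezoid.rowSums T₂)
      ; central = λ c lo hi → trans (colSum-stack-inner c (Central⇒IsColumn {n₁} {l} (lo , hi))) (IsASTrapezoid.central T₁ c lo hi)
      ; rowAlt = stack-rows (λ r → Alternating (nonzeros r)) (IsASTrapezoid.rowAlt T₁) (IsASTrapezoid.rowAlt T₂)
      ; colAlt = λ c _ → proj₁ (Walk01⇒Alternating (column-stack-Walk01 c))
      ; colFirst = λ c _ → proj₂ (Walk01⇒Alternating (column-stack-Walk01 c))
      }

    module _ (1≤l : 1 ℕ.≤ l) where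

      1≤l₂ : 1 ℕ.≤ l ℕ.+ 2 ℕ.* n₁
      1≤l₂ = ℕP.≤-trans 1≤l (ℕP.m≤m+n l (2 ℕ.* n₁))

      In𝒮ᶜ-A₁⇒stack : ∀ x → In𝒮ᶜ n₁ l A₁ x → In𝒮ᶜ (n₂ ℕ.+ n₁) l B x
      In𝒮ᶜ-A₁⇒stack x (inj₁ x≡0) = inj₁ x≡0
      In𝒮ᶜ-A₁⇒stack x (inj₂ (x≢0 , ∣x∣≤n₁ , sum≡1)) =
        inj₂ (x≢0 , ℕP.≤-trans ∣x∣≤n₁ (ℕP.m≤n+m n₁ n₂) ,
              trans (colSum-stack-inner _ (∣∣≤⇒IsColumn-columnOf x 1≤l x≢0 ∣x∣≤n₁)) sum≡1)

      In𝒮ᶜ-A₂⇒stack : ∀ y → In𝒮ᶜ n₂ (l ℕ.+ 2 ℕ.* n₁) A₂ y → In𝒮ᶜ (n₂ ℕ.+ n₁) l B (shift n₁ y)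
      In𝒮ᶜ-A₂⇒stack y (inj₁ refl) = inj₁ refl
      In𝒮ᶜ-A₂⇒stack y (inj₂ (y≢0 , ∣y∣≤n₂ , sum≡1)) =
        inj₂ (shift-≢0 n₁ y y≢0 ,
              subst (ℕ._≤ n₂ ℕ.+ n₁) (sym (∣shift∣ n₁ y y≢0)) (ℕP.+-monoˡ-≤ n₁ ∣y∣≤n₂) ,
              trans (colSum-stack-outer _ (columnOf-shift-outside y y≢0))
                    (trans (cong (colSum n₂ A₂) (columnOf-shift-+ l n₁ y y≢0)) sum≡1))

      stack-In𝒮ᶜ⇒ : ∀ x → In𝒮ᶜ (n₂ ℕ.+ n₁) l B x →
        In𝒮ᶜ n₁ l A₁ x ⊎ Σ ℤ λ y → In𝒮ᶜ n₂ (l ℕ.+ 2 ℕ.* n₁) A₂ y × shift n₁ y ≡ x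
      stack-In𝒮ᶜ⇒ x (inj₁ x≡0) = inj₁ (inj₁ x≡0)
      stack-In𝒮ᶜ⇒ x (inj₂ (x≢0 , ∣x∣≤n , sum≡1)) with ℤ.∣ x ∣ ℕ.≤? n₁
      ... | yes ∣x∣≤n₁ =
        inj₁ (inj₂ (x≢0 , ∣x∣≤n₁ ,
                    trans (sym (colSum-stack-inner _ (∣∣≤⇒IsColumn-columnOf x 1≤l x≢0 ∣x∣≤n₁))) sum≡1))
      ... | no ∣x∣≰n₁ with shift-surjective n₁ x x≢0 (ℕP.≰⇒> ∣x∣≰n₁)
      ... | y , y≢0 , refl = inj₂ (y , inj₂ (y≢0 , ∣y∣≤n₂ , sum₂≡1) , refl)
        where
        ∣y∣≤n₂ : ℤ.∣ y ∣ ℕ.≤ n₂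
        ∣y∣≤n₂ = ℕP.+-cancelʳ-≤ n₁ _ n₂ (subst (ℕ._≤ n₂ ℕ.+ n₁) (∣shift∣ n₁ y y≢0) ∣x∣≤n)
        sum₂≡1 : colSum n₂ A₂ (columnOf (l ℕ.+ 2 ℕ.* n₁) y) ≡ 1ℤ
        sum₂≡1 = trans (cong (colSum n₂ A₂) (sym (columnOf-shift-+ l n₁ y y≢0)))
                   (trans (sym (colSum-stack-outer _ (columnOf-shift-outside y y≢0))) sum≡1)

      stack-𝒮≡ : ∀ {S₁ S₂ S} → IsShiftedUnion n₁ S₁ S₂ S →
        𝒮≡ n₁ l A₁ S₁ → 𝒮≡ n₂ (l ℕ.+ 2 ℕ.* n₁) A₂ S₂ → 𝒮≡ (n₂ ℕ.+ n₁) l B S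
      stack-𝒮≡ {S = S} U 𝒮₁ 𝒮₂ = 𝒮≡-intro 1≤l stack-IsASTrapezoid sound complete
        where
        open IsShiftedUnion U
        sound : ∀ x → In𝒮ᶜ (n₂ ℕ.+ n₁) l B x → x ∈ S
        sound x inB with stack-In𝒮ᶜ⇒ x inB
        ... | inj₁ in₁ = ∈⁺ˡ (In𝒮ᶜ⇒∈ 1≤l 𝒮₁ in₁)
        ... | inj₂ (y , in₂ , refl) = ∈⁺ʳ (In𝒮ᶜ⇒∈ 1≤l₂ 𝒮₂ in₂)
        complete : ∀ x → x ∈ S → In𝒮ᶜ (n₂ ℕ.+ n₁) l B x
        complete x x∈S with ∈⁻ x∈S
        ... | inj₁ x∈S₁ = In𝒮ᶜ-A₁⇒stack x (∈⇒In𝒮ᶜ T₁ 𝒮₁ x∈S₁)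
        ... | inj₂ x∈𝔰S₂ with ∈-map⁻ (shift n₁) x∈𝔰S₂
        ... | y , y∈S₂ , refl = In𝒮ᶜ-A₂⇒stack y (∈⇒In𝒮ᶜ T₂ 𝒮₂ y∈S₂)

  module Splitting {l n₁ n₂ A} (1≤l : 1 ℕ.≤ l) (TA : IsASTrapezoid (n₂ ℕ.+ n₁) l A)
    {S₁ S₂ S} (U : IsShiftedUnion n₁ S₁ S₂ S) (𝒮A : 𝒮≡ (n₂ ℕ.+ n₁) l A S)
    (0∈S₁ : 0ℤ ∈ S₁) (S₁-bounded : ∀ {x} → x ∈ S₁ → ℤ.∣ x ∣ ℕ.≤ n₁)
    (0∈S₂ : 0ℤ ∈ S₂) (S₂-unique : Unique S₂) (S₂-length : length S₂ ≡ suc n₂) where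

    open IsShiftedUnion U

    n l₂ : ℕ
    n = n₂ ℕ.+ n₁
    l₂ = l ℕ.+ 2 ℕ.* n₁

    1≤l₂ : 1 ℕ.≤ l₂
    1≤l₂ = ℕP.≤-trans 1≤l (ℕP.m≤m+n l (2 ℕ.* n₁))

    upper : ℤ → ℤ
    upper = colSum n₂ (dropRows n₁ A)

    column-split-Walk01 : ∀ c → Walk01 false (colList n₂ (dropRows n₁ A) c ++ colList n₁ A c)
    column-split-Walk01 c = subst (Walk01 false) (colList-+ n₂ n₁ A c) (column-Walk01 TA c)

    upper-Walk01 : ∀ c → Walk01 false (colList n₂ (dropRows n₁ A) c)
    upper-Walk01 c = proj₁ (Walk01-split _ (column-split-Walk01 c))

    upper-total : sumℤ (map upper (range (1ℤ - + n) (l ℕ.+ 2 ℕ.* n ℕ.∸ 1))) ≡ + n₂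
    upper-total = begin
      sumℤ (map upper window)
        ≡⟨ sumℤ-map-swap (λ j c → A (j ℕ.+ n₁) c) (rowsTopDown n₂) window ⟩
      sumℤ (map (λ j → sumℤ (map (A (j ℕ.+ n₁)) window)) (rowsTopDown n₂))
        ≡⟨ cong sumℤ (map-rowsTopDown-cong n₂ row-sum) ⟩
      sumℤ (map (λ _ → 1ℤ) (rowsTopDown n₂))
        ≡⟨ sumℤ-ones n₂ ⟩
      + n₂ ∎
      where
      open ≡-Reasoning
      window : List ℤ
      window = range (1ℤ - + n) (l ℕ.+ 2 ℕ.* n ℕ.∸ 1)
      row-sum : ∀ j → 1 ℕ.≤ j → j ℕ.≤ n₂ → sumℤ (map (A (j ℕ.+ n₁)) window) ≡ 1ℤ
      row-sum j 1≤j j≤n₂ =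
        trans (rowList-window TA (j ℕ.+ n₁) 1≤j+n₁ j+n₁≤n) (IsASTrapezoid.rowSums TA (j ℕ.+ n₁) 1≤j+n₁ j+n₁≤n)
        where
        1≤j+n₁ : 1 ℕ.≤ j ℕ.+ n₁
        1≤j+n₁ = ℕP.≤-trans 1≤j (ℕP.m≤m+n j n₁)
        j+n₁≤n : j ℕ.+ n₁ ℕ.≤ n
        j+n₁≤n = ℕP.+-monoˡ-≤ n₁ j≤n₂

    outerColumn : ℤ → ℤ
    outerColumn y = columnOf l (shift n₁ y)

    outerColumn-upper : ∀ {y} → y ≢ 0ℤ → y ∈ S₂ → IsColumn n l (outerColumn y) × upper (outerColumn y) ≡ 1ℤ
    outerColumn-upper {y} y≢0 y∈S₂ with ∈⇒In𝒮ᶜ TA 𝒮A (∈⁺ʳ y∈S₂)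
    ... | inj₁ shift≡0 = ⊥-elim (shift-≢0 n₁ y y≢0 shift≡0)
    ... | inj₂ (x≢0 , ∣x∣≤n , sum≡1) =
      ∣∣≤⇒IsColumn-columnOf _ 1≤l x≢0 ∣x∣≤n ,
      (begin
        upper (outerColumn y)                                   ≡⟨ sym (ℤP.+-identityʳ _) ⟩
        upper (outerColumn y) + 0ℤ                              ≡⟨ cong (λ t → upper (outerColumn y) + t) (sym lower≡0) ⟩
        upper (outerColumn y) + colSum n₁ A (outerColumn y)     ≡⟨ sym (colSum-+ n₂ n₁ A _) ⟩
        colSum n A (outerColumn y)                              ≡⟨ sum≡1 ⟩
        1ℤ ∎)
      where
      open ≡-Reasoning
      lower≡0 : colSum n₁ A (outerColumn y) ≡ 0ℤ
      lower≡0 = colSum-outside-zero TA n₁ _ (columnOf-shift-outside y y≢0)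

    upper-inner≡0 : ∀ c → IsColumn n₁ l c → upper c ≡ 0ℤ
    upper-inner≡0 c col with Walk01-sum01 (upper-Walk01 c)
    ... | inj₁ upper≡0 = upper≡0
    ... | inj₂ upper≡1 with remove S₂-unique 0∈S₂
    ... | S₂′ , S₂′-removal = ⊥-elim (ℕP.<-irrefl refl (ℤP.drop‿+≤+ (subst (ℤ._≤ + n₂) (cong +_ length-L) counted)))
      where
      module R = Removal S₂′-removal
      L : List ℤ
      L = c ∷ map outerColumn S₂′
      length-L : length L ≡ suc n₂
      length-L = cong suc (trans (ListP.length-map outerColumn S₂′) (ℕP.suc-injective (trans (sym R.length-suc) S₂-length)))
      outer≢0 : ∀ {y} → y ∈ S₂′ → y ≢ 0ℤ
      outer≢0 y∈ = All.lookup R.all≢ y∈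
      c∉ : All (c ≢_) (map outerColumn S₂′)
      c∉ = AllP.map⁺ (All.tabulate (λ {y} y∈ c≡ → columnOf-shift-outside y (outer≢0 y∈) (subst (IsColumn n₁ l) c≡ col)))
      outerColumn-injective : ∀ {x y} → x ≢ 0ℤ → y ≢ 0ℤ → outerColumn x ≡ outerColumn y → x ≡ y
      outerColumn-injective {x} {y} x≢0 y≢0 eq =
        shift-injective n₁ x y (columnOf-injective _ _ 1≤l (shift-≢0 n₁ x x≢0) (shift-≢0 n₁ y y≢0) eq)
      L-unique : Unique L
      L-unique = c∉ ∷ Unique-map⁺-on outerColumn R.all≢ outerColumn-injective R.unique
      L⊆window : ∀ {d} → d ∈ L → d ∈ range (1ℤ - + n) (l ℕ.+ 2 ℕ.* n ℕ.∸ 1)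
      L⊆window (here refl) = IsColumn⇒∈-window {n} {l} 1≤l (IsColumn-mono {l = l} (ℕP.m≤n+m n₁ n₂) col)
      L⊆window (there d∈) with ∈-map⁻ outerColumn d∈
      ... | y , y∈ , refl = IsColumn⇒∈-window 1≤l (proj₁ (outerColumn-upper (outer≢0 y∈) (R.∈⁻ y∈)))
      L-upper≡1 : ∀ {d} → d ∈ L → upper d ≡ 1ℤ
      L-upper≡1 (here refl) = upper≡1
      L-upper≡1 (there d∈) with ∈-map⁻ outerColumn d∈
      ... | y , y∈ , refl = proj₂ (outerColumn-upper (outer≢0 y∈) (R.∈⁻ y∈))
      counted : + length L ℤ.≤ + n₂
      counted = subst (+ length L ℤ.≤_) upper-total
        (length≤sumℤ-map upper _ L L-unique (λ d → Walk01-sum-nonneg (upper-Walk01 d)) L⊆window L-upper≡1)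

    B₁ B₂ : Array
    B₁ = bottomRows n₁ A
    B₂ = topRows n₁ A

    colSum-bottom-inner : ∀ c → IsColumn n₁ l c → colSum n₁ B₁ c ≡ colSum n A c
    colSum-bottom-inner c col = begin
      colSum n₁ B₁ c           ≡⟨ cong sumℤ (colList-bottomRows n₁ A c) ⟩
      colSum n₁ A c            ≡⟨ sym (ℤP.+-identityˡ _) ⟩
      0ℤ + colSum n₁ A c       ≡⟨ cong (_+ colSum n₁ A c) (sym (upper-inner≡0 c col)) ⟩
      upper c + colSum n₁ A c  ≡⟨ sym (colSum-+ n₂ n₁ A c) ⟩
      colSum n A c             ∎
      where open ≡-Reasoning

    bottom-Walk01 : ∀ c → IsColumn n₁ l c → Walk01 false (colList n₁ B₁ c)
    bottom-Walk01 c col = subst (Walk01 false) (sym (colList-bottomRows n₁ A c))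
      (Walk01-drop-balanced (colList n₂ (dropRows n₁ A) c) (column-split-Walk01 c) (upper-inner≡0 c col))

    bottom-entries : ∀ i c → IsEntry (B₁ i c)
    bottom-entries i c with i ℕ.≤ᵇ n₁
    ... | true = IsASTrapezoid.entries TA i c
    ... | false = inj₁ refl

    bottom-support : ∀ i c → B₁ i c ≢ 0ℤ → InShape n₁ l i c
    bottom-support i c B₁≢0 with i ℕ.≤ᵇ n₁ in i≤ᵇn₁
    ... | true = let (1≤i , _ , col) = IsASTrapezoid.support TA i c B₁≢0 in
                 1≤i , ℕP.≤ᵇ⇒≤ i n₁ (subst T (sym i≤ᵇn₁) tt) , col
    ... | false = ⊥-elim (B₁≢0 refl)

    bottom-IsASTrapezoid : IsASTrapezoid n₁ l B₁
    bottom-IsASTrapezoid = record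
      { entries = bottom-entries
      ; support = bottom-support
      ; rowSums = λ i 1≤i i≤n₁ → trans (cong sumℤ (rowList-bottomRows l n₁ A i i≤n₁))
                                   (IsASTrapezoid.rowSums TA i 1≤i (ℕP.≤-trans i≤n₁ (ℕP.m≤n+m n₁ n₂)))
      ; central = λ c lo hi → trans (colSum-bottom-inner c (Central⇒IsColumn {n₁} {l} (lo , hi))) (IsASTrapezoid.central TA c lo hi)
      ; rowAlt = λ i 1≤i i≤n₁ → subst (λ r → Alternating (nonzeros r)) (sym (rowList-bottomRows l n₁ A i i≤n₁))
                                  (IsASTrapezoid.rowAlt TA i 1≤i (ℕP.≤-trans i≤n₁ (ℕP.m≤n+m n₁ n₂)))
      ; colAlt = λ c col → proj₁ (Walk01⇒Alternating (bottom-Walk01 c col))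
      ; colFirst = λ c col → proj₂ (Walk01⇒Alternating (bottom-Walk01 c col))
      }

    bottom-𝒮≡ : 𝒮≡ n₁ l B₁ S₁
    bottom-𝒮≡ = 𝒮≡-intro 1≤l bottom-IsASTrapezoid sound complete
      where
      sound : ∀ x → In𝒮ᶜ n₁ l B₁ x → x ∈ S₁
      sound x (inj₁ refl) = 0∈S₁
      sound x (inj₂ (x≢0 , ∣x∣≤n₁ , sum≡1)) with ∈⁻ (In𝒮ᶜ⇒∈ 1≤l 𝒮A (inj₂ (x≢0 , ∣x∣≤n , sumA≡1)))
        where
        col : IsColumn n₁ l (columnOf l x)
        col = ∣∣≤⇒IsColumn-columnOf x 1≤l x≢0 ∣x∣≤n₁
        ∣x∣≤n : ℤ.∣ x ∣ ℕ.≤ n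
        ∣x∣≤n = ℕP.≤-trans ∣x∣≤n₁ (ℕP.m≤n+m n₁ n₂)
        sumA≡1 : colSum n A (columnOf l x) ≡ 1ℤ
        sumA≡1 = trans (sym (colSum-bottom-inner _ col)) sum≡1
      ... | inj₁ x∈S₁ = x∈S₁
      ... | inj₂ x∈𝔰S₂ with ∈-map⁻ (shift n₁) x∈𝔰S₂
      ... | y , _ , refl with y ℤ.≟ 0ℤ
      ... | yes refl = ⊥-elim (x≢0 refl)
      ... | no y≢0 = ⊥-elim (columnOf-shift-outside y y≢0 (∣∣≤⇒IsColumn-columnOf _ 1≤l x≢0 ∣x∣≤n₁))
      complete : ∀ x → x ∈ S₁ → In𝒮ᶜ n₁ l B₁ x
      complete x x∈S₁ with ∈⇒In𝒮ᶜ TA 𝒮A (∈⁺ˡ x∈S₁)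
      ... | inj₁ x≡0 = inj₁ x≡0
      ... | inj₂ (x≢0 , _ , sum≡1) =
        inj₂ (x≢0 , S₁-bounded x∈S₁ ,
              trans (colSum-bottom-inner _ (∣∣≤⇒IsColumn-columnOf x 1≤l x≢0 (S₁-bounded x∈S₁))) sum≡1)

    colSum-top : ∀ c → colSum n₂ B₂ c ≡ upper (c - + n₁)
    colSum-top c = cong sumℤ (colList-topRows n₂ n₁ A c)

    top-Walk01 : ∀ c → Walk01 false (colList n₂ B₂ c)
    top-Walk01 c = subst (Walk01 false) (sym (colList-topRows n₂ n₁ A c)) (upper-Walk01 (c - + n₁))

    top-entries : ∀ i c → IsEntry (B₂ i c)
    top-entries zero c = inj₁ refl
    top-entries (suc j) c = IsASTrapezoid.entries TA (suc j ℕ.+ n₁) (c - + n₁)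

    top-support : ∀ i c → B₂ i c ≢ 0ℤ → InShape n₂ l₂ i c
    top-support zero c B₂≢0 = ⊥-elim (B₂≢0 refl)
    top-support (suc j) c B₂≢0 =
      InShape-unstack {n₁} {n₂} {l} (ℕ.s≤s ℕ.z≤n) (IsASTrapezoid.support TA (suc j ℕ.+ n₁) (c - + n₁) B₂≢0)

    top-rows : (P : List ℤ → Set) → (∀ i → 1 ℕ.≤ i → i ℕ.≤ n → P (rowList l A i)) →
      ∀ j → 1 ℕ.≤ j → j ℕ.≤ n₂ → P (rowList l₂ B₂ j)
    top-rows P rows j 1≤j j≤n₂ =
      subst P (sym (rowList-topRows l n₁ A j 1≤j))
        (rows (j ℕ.+ n₁) (ℕP.≤-trans 1≤j (ℕP.m≤m+n j n₁)) (ℕP.+-monoˡ-≤ n₁ j≤n₂))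

    top-IsASTrapezoid : IsASTrapezoid n₂ l₂ B₂
    top-IsASTrapezoid = record
      { entries = top-entries
      ; support = top-support
      ; rowSums = top-rows (λ r → sumℤ r ≡ 1ℤ) (IsASTrapezoid.rowSums TA)
      ; central = λ c lo hi → trans (colSum-top c)
          (upper-inner≡0 (c - + n₁) (IsColumn-raise {0} {n₁} {l} (Central⇒IsColumn-zero {l₂} (lo , hi))))
      ; rowAlt = top-rows (λ r → Alternating (nonzeros r)) (IsASTrapezoid.rowAlt TA)
      ; colAlt = λ c _ → proj₁ (Walk01⇒Alternating (top-Walk01 c))
      ; colFirst = λ c _ → proj₂ (Walk01⇒Alternating (top-Walk01 c))
      }

    colSum-top-columnOf : ∀ y → y ≢ 0ℤ → colSum n₂ B₂ (columnOf l₂ y) ≡ upper (outerColumn y)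
    colSum-top-columnOf y y≢0 = trans (colSum-top _) (cong upper (sym (columnOf-shift l n₁ y y≢0)))

    top-𝒮≡ : 𝒮≡ n₂ l₂ B₂ S₂
    top-𝒮≡ = 𝒮≡-intro 1≤l₂ top-IsASTrapezoid sound complete
      where
      sound : ∀ y → In𝒮ᶜ n₂ l₂ B₂ y → y ∈ S₂
      sound y (inj₁ refl) = 0∈S₂
      sound y (inj₂ (y≢0 , ∣y∣≤n₂ , sum≡1)) with ∈⁻ (In𝒮ᶜ⇒∈ 1≤l 𝒮A (inj₂ (shift-≢0 n₁ y y≢0 , ∣x∣≤n , sumA≡1)))
        where
        ∣x∣≤n : ℤ.∣ shift n₁ y ∣ ℕ.≤ n
        ∣x∣≤n = subst (ℕ._≤ n) (sym (∣shift∣ n₁ y y≢0)) (ℕP.+-monoˡ-≤ n₁ ∣y∣≤n₂)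
        lower≡0 : colSum n₁ A (outerColumn y) ≡ 0ℤ
        lower≡0 = colSum-outside-zero TA n₁ _ (columnOf-shift-outside y y≢0)
        sumA≡1 : colSum n A (outerColumn y) ≡ 1ℤ
        sumA≡1 = begin
          colSum n A (outerColumn y)                             ≡⟨ colSum-+ n₂ n₁ A _ ⟩
          upper (outerColumn y) + colSum n₁ A (outerColumn y)    ≡⟨ cong (λ t → upper (outerColumn y) + t) lower≡0 ⟩
          upper (outerColumn y) + 0ℤ                             ≡⟨ ℤP.+-identityʳ _ ⟩
          upper (outerColumn y)                                  ≡⟨ sym (colSum-top-columnOf y y≢0) ⟩
          colSum n₂ B₂ (columnOf l₂ y)                           ≡⟨ sum≡1 ⟩
          1ℤ                                                     ∎
          where open ≡-Reasoning
      ... | inj₁ x∈S₁ = ⊥-elim (ℕP.<⇒≱ (k<∣shift∣ n₁ y y≢0) (S₁-bounded x∈S₁))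
      ... | inj₂ x∈𝔰S₂ with ∈-map⁻ (shift n₁) x∈𝔰S₂
      ... | y′ , y′∈S₂ , eq = subst (_∈ S₂) (sym (shift-injective n₁ y y′ eq)) y′∈S₂
      complete : ∀ y → y ∈ S₂ → In𝒮ᶜ n₂ l₂ B₂ y
      complete y y∈S₂ with y ℤ.≟ 0ℤ
      ... | yes y≡0 = inj₁ y≡0
      ... | no y≢0 =
        let (col , upper≡1) = outerColumn-upper y≢0 y∈S₂
            ∣x∣≤n = IsColumn-columnOf⇒∣∣≤ (shift n₁ y) (shift-≢0 n₁ y y≢0) col
        in inj₂ (y≢0 , ℕP.+-cancelʳ-≤ n₁ _ n₂ (subst (ℕ._≤ n) (∣shift∣ n₁ y y≢0) ∣x∣≤n) ,
                 trans (colSum-top-columnOf y y≢0) upper≡1)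

    stack-bottom-top : ∀ i c → stack n₁ B₁ B₂ i c ≡ A i c
    stack-bottom-top i c with i ℕ.≤? n₁
    ... | yes i≤n₁ = trans (stack-below {n₁} {B₁} {B₂} i≤n₁) (bottomRows-below {n₁} {A} i≤n₁)
    ... | no i≰n₁ with row-above n₁ i i≰n₁
    ... | suc j , 1≤j , refl = trans (stack-above {n₁} {B₁} {B₂} 1≤j) (cong (A (suc j ℕ.+ n₁)) (i+j-j≡i c (+ n₁)))

  -- Composition of centred Catalan sets

  bounds⇒∣i∣≤n : ∀ n x → 1ℤ - + suc n ℤ.≤ x → x ℤ.≤ + suc n - 1ℤ → ℤ.∣ x ∣ ℕ.≤ n
  bounds⇒∣i∣≤n n (+ a) _ hi = ℤP.drop‿+≤+ (subst (+ a ℤ.≤_) (ring (+ n)) hi)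
    where
    ring : ∀ N → 1ℤ + N - 1ℤ ≡ N
    ring = solve-∀
  bounds⇒∣i∣≤n n -[1+ m ] lo _ = ℤP.drop‿+≤+ (ℤP.neg-cancel-≤ (subst (ℤ._≤ -[1+ m ]) (ring (+ n)) lo))
    where
    ring : ∀ N → 1ℤ - (1ℤ + N) ≡ - N
    ring = solve-∀

  0∈centredCatalan : ∀ {S} → IsCentredCatalan S → 1 ℕ.≤ length S → 0ℤ ∈ S
  0∈centredCatalan {S} C 1≤|S| =
    let (y , y∈) = element (IsCentredCatalan.catalan C 0 1≤|S|)
        (y∈S , ∣y∣≤0) = ∈-filter⁻ (λ x → ℤ.∣ x ∣ ℕ.≤? 0) {xs = S} y∈
    in subst (_∈ S) (ℤP.∣i∣≡0⇒i≡0 (ℕP.n≤0⇒n≡0 ∣y∣≤0)) y∈S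
    where
    element : ∀ {xs : List ℤ} → 1 ℕ.≤ length xs → Σ ℤ (_∈ xs)
    element {x ∷ _} _ = x , here refl

  centredCatalan-bounded : ∀ {S x} → IsCentredCatalan S → x ∈ S → ℤ.∣ x ∣ ℕ.≤ length S ℕ.∸ 1
  centredCatalan-bounded {y ∷ S} {x} C x∈S =
    let (lo , hi) = All.lookup (IsCentredCatalan.bounds C) x∈S in bounds⇒∣i∣≤n (length S) x lo hi

  -- S₁ ∘ S₂ is, as a set, the disjoint union of S₁ and 𝔰(S₂ ∖ {0}); both sides are repetition-free,
  -- hence bag-equal.
  length-∘ₛ : ∀ {S₁ S₂} → IsCentredCatalan S₁ → IsCentredCatalan S₂ → 1 ℕ.≤ length S₁ → 1 ℕ.≤ length S₂ →
    length (S₁ ∘ₛ S₂) ℕ.∸ 1 ≡ (length S₂ ℕ.∸ 1) ℕ.+ (length S₁ ℕ.∸ 1)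
  length-∘ₛ {S₁@(_ ∷ S₁-tail)} {S₂@(_ ∷ S₂-tail)} C₁ C₂ _ _
    with remove (IsCentredCatalan.unique C₂) (0∈centredCatalan C₂ (ℕ.s≤s ℕ.z≤n))
  ... | S₂′ , S₂′-removal = cong (ℕ._∸ 1) (begin
    length (S₁ ∘ₛ S₂)                                 ≡⟨ ↭-length ∘ₛ↭E ⟩
    length E                                          ≡⟨ ListP.length-++ S₁ ⟩
    length S₁ ℕ.+ length (map (shift n₁) S₂′)         ≡⟨ cong (length S₁ ℕ.+_) (ListP.length-map (shift n₁) S₂′) ⟩
    suc n₁ ℕ.+ length S₂′                             ≡⟨ cong suc (ℕP.+-comm n₁ _) ⟩
    suc (length S₂′ ℕ.+ n₁)                           ≡⟨ cong (λ k → suc (k ℕ.+ n₁)) (ℕP.suc-injective (sym R.length-suc)) ⟩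
    suc (length S₂-tail ℕ.+ n₁)                       ∎)
    where
    open ≡-Reasoning
    module R = Removal S₂′-removal
    open IsShiftedUnion (∘ₛ-IsShiftedUnion S₁ S₂)
    n₁ : ℕ
    n₁ = length S₁-tail
    E : List ℤ
    E = S₁ ++ map (shift n₁) S₂′
    disjoint : ∀ {x} → ¬ (x ∈ S₁ × x ∈ map (shift n₁) S₂′)
    disjoint (x∈S₁ , x∈𝔰S₂′) with ∈-map⁻ (shift n₁) x∈𝔰S₂′
    ... | y , y∈ , refl = ℕP.<⇒≱ (k<∣shift∣ n₁ y (All.lookup R.all≢ y∈)) (centredCatalan-bounded C₁ x∈S₁)
    E-unique : Unique E
    E-unique = UniqueP.++⁺ (IsCentredCatalan.unique C₁)
      (Unique-map⁺-on {P = λ _ → ⊤} (shift n₁) (All.tabulate (λ _ → tt)) (λ _ _ → shift-injective n₁ _ _) R.unique) disjoint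
    to : ∀ {x} → x ∈ S₁ ∘ₛ S₂ → x ∈ E
    to x∈S with ∈⁻ x∈S
    ... | inj₁ x∈S₁ = ∈-++⁺ˡ x∈S₁
    ... | inj₂ x∈𝔰S₂ with ∈-map⁻ (shift n₁) x∈𝔰S₂
    ... | y , y∈S₂ , refl with y ℤ.≟ 0ℤ
    ... | yes refl = ∈-++⁺ˡ (0∈centredCatalan C₁ (ℕ.s≤s ℕ.z≤n))
    ... | no y≢0 = ∈-++⁺ʳ S₁ (∈-map⁺ (shift n₁) (R.∈⁺ y∈S₂ y≢0))
    from : ∀ {x} → x ∈ E → x ∈ S₁ ∘ₛ S₂
    from x∈E with ∈-++⁻ S₁ x∈E
    ... | inj₁ x∈S₁ = ∈⁺ˡ x∈S₁
    ... | inj₂ x∈𝔰S₂′ with ∈-map⁻ (shift n₁) x∈𝔰S₂′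
    ... | y , y∈ , refl = ∈⁺ʳ (R.∈⁻ y∈)
    ∘ₛ↭E : S₁ ∘ₛ S₂ ↭ E
    ∘ₛ↭E = ∼bag⇒↭ (unique∧set⇒bag (deduplicate-! (S₁ ++ map (shift n₁) S₂)) E-unique (mk⇔ to from))

  ∘ₛ-stack : ∀ {l S₁ S₂ A₁ A₂} → 1 ℕ.≤ l → IsCentredCatalan S₁ → IsCentredCatalan S₂ → 1 ℕ.≤ length S₁ → 1 ℕ.≤ length S₂ →
    IsASTrapezoid (length S₁ ℕ.∸ 1) l A₁ → 𝒮≡ (length S₁ ℕ.∸ 1) l A₁ S₁ →
    IsASTrapezoid (length S₂ ℕ.∸ 1) (l ℕ.+ 2 ℕ.* (length S₁ ℕ.∸ 1)) A₂ →
    𝒮≡ (length S₂ ℕ.∸ 1) (l ℕ.+ 2 ℕ.* (length S₁ ℕ.∸ 1)) A₂ S₂ →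
    IsASTrapezoid (length (S₁ ∘ₛ S₂) ℕ.∸ 1) l (stack (length S₁ ℕ.∸ 1) A₁ A₂)
    × 𝒮≡ (length (S₁ ∘ₛ S₂) ℕ.∸ 1) l (stack (length S₁ ℕ.∸ 1) A₁ A₂) (S₁ ∘ₛ S₂)
  ∘ₛ-stack {l} {S₁} {S₂} 1≤l C₁ C₂ 1≤|S₁| 1≤|S₂| T₁ 𝒮₁ T₂ 𝒮₂ =
    subst (λ N → IsASTrapezoid N l B × 𝒮≡ N l B (S₁ ∘ₛ S₂)) (sym (length-∘ₛ C₁ C₂ 1≤|S₁| 1≤|S₂|))
      (stack-IsASTrapezoid , stack-𝒮≡ 1≤l (∘ₛ-IsShiftedUnion S₁ S₂) 𝒮₁ 𝒮₂)
    where
    open Stacking T₁ T₂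

  ∘ₛ-split : ∀ {l S₁ S₂ A} → 1 ℕ.≤ l → IsCentredCatalan S₁ → IsCentredCatalan S₂ → 1 ℕ.≤ length S₁ → 1 ℕ.≤ length S₂ →
    IsASTrapezoid (length (S₁ ∘ₛ S₂) ℕ.∸ 1) l A → 𝒮≡ (length (S₁ ∘ₛ S₂) ℕ.∸ 1) l A (S₁ ∘ₛ S₂) →
    IsASTrapezoid (length S₁ ℕ.∸ 1) l (bottomRows (length S₁ ℕ.∸ 1) A)
    × 𝒮≡ (length S₁ ℕ.∸ 1) l (bottomRows (length S₁ ℕ.∸ 1) A) S₁
    × IsASTrapezoid (length S₂ ℕ.∸ 1) (l ℕ.+ 2 ℕ.* (length S₁ ℕ.∸ 1)) (topRows (length S₁ ℕ.∸ 1) A)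
    × 𝒮≡ (length S₂ ℕ.∸ 1) (l ℕ.+ 2 ℕ.* (length S₁ ℕ.∸ 1)) (topRows (length S₁ ℕ.∸ 1) A) S₂
    × (∀ i c → stack (length S₁ ℕ.∸ 1) (bottomRows (length S₁ ℕ.∸ 1) A) (topRows (length S₁ ℕ.∸ 1) A) i c ≡ A i c)
  ∘ₛ-split {l} {S₁} {S₂} {A} 1≤l C₁ C₂ 1≤|S₁| 1≤|S₂| T 𝒮 =
    bottom-IsASTrapezoid , bottom-𝒮≡ , top-IsASTrapezoid , top-𝒮≡ , stack-bottom-top
    where
    |S₁∘S₂| : length (S₁ ∘ₛ S₂) ℕ.∸ 1 ≡ (length S₂ ℕ.∸ 1) ℕ.+ (length S₁ ℕ.∸ 1)
    |S₁∘S₂| = length-∘ₛ C₁ C₂ 1≤|S₁| 1≤|S₂|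
    open Splitting 1≤l (subst (λ N → IsASTrapezoid N l A) |S₁∘S₂| T) (∘ₛ-IsShiftedUnion S₁ S₂)
      (subst (λ N → 𝒮≡ N l A (S₁ ∘ₛ S₂)) |S₁∘S₂| 𝒮)
      (0∈centredCatalan C₁ 1≤|S₁|) (centredCatalan-bounded C₁)
      (0∈centredCatalan C₂ 1≤|S₂|) (IsCentredCatalan.unique C₂) (sym (ℕP.m+[n∸m]≡n 1≤|S₂|))

open Composition
open import Data.Nat using (ℕ; _≤_; _+_; _*_; _∸_)
open import Data.Integer using (ℤ)
open import Data.List using (List; length)
open import Data.Product using (_×_; _,_)
open import Relation.Binary.PropositionalEquality using (_≡_)

lemma3p2 : (l : ℕ) → 1 ≤ l → (S₁ S₂ : List ℤ) →
  IsCentredCatalan S₁ → IsCentredCatalan S₂ → 1 ≤ length S₁ → 1 ≤ length S₂ →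
  ((A₁ A₂ : Array) →
    IsASTrapezoid (length S₁ ∸ 1) l A₁ → 𝒮≡ (length S₁ ∸ 1) l A₁ S₁ →
    IsASTrapezoid (length S₂ ∸ 1) (l + 2 * (length S₁ ∸ 1)) A₂ →
    𝒮≡ (length S₂ ∸ 1) (l + 2 * (length S₁ ∸ 1)) A₂ S₂ →
    IsASTrapezoid (length (S₁ ∘ₛ S₂) ∸ 1) l (stack (length S₁ ∸ 1) A₁ A₂)
    × 𝒮≡ (length (S₁ ∘ₛ S₂) ∸ 1) l (stack (length S₁ ∸ 1) A₁ A₂) (S₁ ∘ₛ S₂))
  × ((A : Array) →
    IsASTrapezoid (length (S₁ ∘ₛ S₂) ∸ 1) l A → 𝒮≡ (length (S₁ ∘ₛ S₂) ∸ 1) l A (S₁ ∘ₛ S₂) →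
    IsASTrapezoid (length S₁ ∸ 1) l (bottomRows (length S₁ ∸ 1) A)
    × 𝒮≡ (length S₁ ∸ 1) l (bottomRows (length S₁ ∸ 1) A) S₁
    × IsASTrapezoid (length S₂ ∸ 1) (l + 2 * (length S₁ ∸ 1)) (topRows (length S₁ ∸ 1) A)
    × 𝒮≡ (length S₂ ∸ 1) (l + 2 * (length S₁ ∸ 1)) (topRows (length S₁ ∸ 1) A) S₂
    × (∀ i c → stack (length S₁ ∸ 1) (bottomRows (length S₁ ∸ 1) A) (topRows (length S₁ ∸ 1) A) i c ≡ A i c))
lemma3p2 l 1≤l S₁ S₂ C₁ C₂ 1≤|S₁| 1≤|S₂| =
  (λ A₁ A₂ → ∘ₛ-stack 1≤l C₁ C₂ 1≤|S₁| 1≤|S₂|) , (λ A → ∘ₛ-split 1≤l C₁ C₂ 1≤|S₁| 1≤|S₂|)
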